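{- For each $n\geq2$, the weighted generating function of closed polygons of the Sierpiński graph $\Omega_n$ with the "rotation-invariant" labeling satisfies, for all real $a,b,c>0$, $$\Gamma^{cl}_n(a,b,c)=\big((a+bc)(b+ac)\big)^{\frac{7\cdot 3^{n-2}}{4}}\psi_1^{3^{n-2}}(a,b,c)\prod_{k=2}^n\psi_k^{3^{n-k}}(a,b,c)\cdot(\psi_{n+1}(a,b,c)-1),$$ where $\psi_1=\frac{1+c}{((a+bc)(b+ac))^{1/4}}$, $\psi_2=\frac{1+ab}{((a+bc)(b+ac))^{1/2}}$, $$\psi_3=\frac{a^2b^2c^2-a^2b^2c+a^2b^2+4abc+c^2-c+1+a^2c+b^2c}{(a+bc)(b+ac)},$$ and $\psi_k=\psi_{k-1}^2-3\psi_{k-1}+4$ for each $k\geq4$ (all $\psi_k$ evaluated at $(a,b,c)$).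
   Context: The labeled graphs $\Omega_n$, $n\geq2$, are defined as follows. $\Omega_2$ has three corner vertices $L$ (left), $T$ (top), $R$ (right) and three further vertices $M_{LT},M_{TR},M_{LR}$ (midpoints of the sides), with edges $L M_{LT}$ labeled $b$, $M_{LT}T$ labeled $a$, $T M_{TR}$ labeled $b$, $M_{TR}R$ labeled $a$, $R M_{LR}$ labeled $b$, $M_{LR}L$ labeled $a$, and the three inner edges $M_{LT}M_{TR}$, $M_{TR}M_{LR}$, $M_{LR}M_{LT}$ labeled $c$ (this labeling is invariant under rotation by $2\pi/3$). For $n\geq3$, $\Omega_n$ is obtained from three labeled copies of $\Omega_{n-1}$ (bottom-left, bottom-right, top) by identifying the corner $R$ of the bottom-left copy with the corner $L$ of the bottom-right copy, the corner $T$ of the bottom-left copy with the corner $L$ of the top copy, and the corner $T$ of the bottom-right copy with the corner $R$ of the top copy, labels being kept; the corners of $\Omega_n$ are $L$ of the bottom-left copy, $R$ of the bottom-right copy and $T$ of the top copy. A closed polygon is a subset of the edge set in which every vertex has even degree (empty set included). The weighted generating function is $\Gamma^{cl}_n(a,b,c)=\sum_X a^{\#a(X)}b^{\#b(X)}c^{\#c(X)}$, summed over closed polygons $X$ of $\Omega_n$, where $\#s(X)$ is the number of edges of $X$ labeled $s$. -}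

module Defs where

open import Level using (Level)
open import Data.Nat as Nat using (ℕ; zero; suc; _∸_; _≟_; _%_)
open import Data.Bool using (Bool; true; false; if_then_else_)
open import Data.List using (List; []; _∷_; map; foldr; _++_; applyUpTo; length; upTo)
open import Data.Product using (_×_; _,_)
open import Relation.Nullary.Decidable using (⌊_⌋)
open import Algebra.Bundles using (CommutativeRing; Semiring)
import Algebra.Definitions.RawSemiring as RawSemiring

module Graphs where
  open Nat using (_+_)

  data Label : Set where
    la lb lc : Label

  Edge : Set
  Edge = ℕ × ℕ × Label

  -- A labeled graph with vertex ids in [0, nv), three distinguished corners,
  -- and a list of (pairwise distinct) labeled edges.
  record LGraph : Set where
    constructor mkLGraph
    field
      nv    : ℕ
      cL    : ℕ
      cT    : ℕ
      cR    : ℕ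
      edges : List Edge
  open LGraph public

  -- Ω_2 : vertices L=0, T=1, R=2, M_LT=3, M_TR=4, M_LR=5.
  Ω₂ : LGraph
  Ω₂ = mkLGraph 6 0 1 2
    ( (0 , 3 , lb) ∷ (3 , 1 , la)
    ∷ (1 , 4 , lb) ∷ (4 , 2 , la)
    ∷ (2 , 5 , lb) ∷ (5 , 0 , la)
    ∷ (3 , 4 , lc) ∷ (4 , 5 , lc) ∷ (5 , 3 , lc)
    ∷ [])

  rn : ℕ → ℕ → ℕ → ℕ
  rn from to v = if ⌊ v ≟ from ⌋ then to else v

  mapEdge : (ℕ → ℕ) → Edge → Edge
  mapEdge f (u , v , l) = (f u , f v , l)

  -- Ω_{n+1} from three copies of G: bottom-left (ids shifted by 0),
  -- bottom-right (shifted by nv), top (shifted by 2·nv), with identifications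
  --   R(bottom-left) = L(bottom-right), T(bottom-left) = L(top),
  --   T(bottom-right) = R(top).
  step : LGraph → LGraph
  step G = mkLGraph (N + N + N) (cL G) (N + N + cT G) (N + cR G)
             (map (mapEdge glue) (e1 ++ e2 ++ e3))
    where
    N = nv G
    shift : ℕ → List Edge
    shift k = map (mapEdge (k +_)) (edges G)
    e1 = shift 0
    e2 = shift N
    e3 = shift (N + N)
    glue : ℕ → ℕ
    glue v = rn (N + cL G) (cR G)
               (rn (N + N + cL G) (cT G)
                 (rn (N + N + cR G) (N + cT G) v))

  -- Ω (k) = Ω_{k+2}
  Ω : ℕ → LGraph
  Ω zero    = Ω₂
  Ω (suc k) = step (Ω k)

  -- all subsets of an m-element list, as characteristic Bool lists
  subsets : ℕ → List (List Bool)
  subsets zero    = [] ∷ []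
  subsets (suc m) = map (true ∷_) (subsets m) ++ map (false ∷_) (subsets m)

  chosen : List Bool → List Edge → List Edge
  chosen (true  ∷ bs) (e ∷ es) = e ∷ chosen bs es
  chosen (false ∷ bs) (e ∷ es) = chosen bs es
  chosen _ _ = []

  deg : ℕ → List Edge → ℕ
  deg v [] = 0
  deg v ((x , y , _) ∷ es) =
    (if ⌊ x ≟ v ⌋ then 1 else 0) + (if ⌊ y ≟ v ⌋ then 1 else 0) + deg v es

  allB : (ℕ → Bool) → List ℕ → Bool
  allB p [] = true
  allB p (x ∷ xs) = if p x then allB p xs else false

  -- closed polygon: every vertex has even degree
  isClosed : LGraph → List Edge → Bool
  isClosed G X = allB (λ v → ⌊ deg v X % 2 ≟ 0 ⌋) (upTo (nv G))


open Graphs public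

module Gen {c ℓ : Level} (R : CommutativeRing c ℓ) where
  open CommutativeRing R
  open RawSemiring (Semiring.rawSemiring semiring) public using (_^_) renaming (_×_ to _·_)

  weight : Carrier → Carrier → Carrier → List Edge → Carrier
  weight a b c' [] = 1#
  weight a b c' ((_ , _ , la) ∷ es) = a * weight a b c' es
  weight a b c' ((_ , _ , lb) ∷ es) = b * weight a b c' es
  weight a b c' ((_ , _ , lc) ∷ es) = c' * weight a b c' es

  sumR : List Carrier → Carrier
  sumR = foldr _+_ 0#

  prodR : List Carrier → Carrier
  prodR = foldr _*_ 1#

  ΓclG : LGraph → Carrier → Carrier → Carrier → Carrier
  ΓclG G a b c' =
    sumR (map (λ s → let X = chosen s (edges G) in
                     if isClosed G X then weight a b c' X else 0#)
              (subsets (length (edges G))))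

  Γcl : ℕ → Carrier → Carrier → Carrier → Carrier
  Γcl n = ΓclG (Ω (n ∸ 2))

  Qf : Carrier → Carrier → Carrier → Carrier
  Qf a b c' = (a + b * c') * (b + a * c')

  -- ψ_k, given qinv = Q^{-1/4} (i.e. qinv is inverse of a fourth root q of Q)
  ψ : Carrier → Carrier → Carrier → Carrier → ℕ → Carrier
  ψ a b c' qinv 0 = 0#   -- unused
  ψ a b c' qinv 1 = (1# + c') * qinv
  ψ a b c' qinv 2 = (1# + a * b) * (qinv ^ 2)
  ψ a b c' qinv 3 =
    ( a ^ 2 * b ^ 2 * c' ^ 2 - a ^ 2 * b ^ 2 * c' + a ^ 2 * b ^ 2
      + 4 · (a * b * c') + c' ^ 2 - c' + 1# + a ^ 2 * c' + b ^ 2 * c')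
    * (qinv ^ 4)
  ψ a b c' qinv (suc (suc (suc (suc k)))) =
    let p = ψ a b c' qinv (suc (suc (suc k))) in p * p - 3 · p + 4 · 1#

  prodψ : Carrier → Carrier → Carrier → Carrier → ℕ → Carrier
  prodψ a b c' qinv n =
    prodR (map (λ k → ψ a b c' qinv k ^ (3 Nat.^ (n ∸ k))) (applyUpTo (Nat._+_ 2) (n ∸ 1)))

-- Cutting Ω_{n+1} into its three copies of Ω_n, an edge set of Ω_{n+1} is a triple of edge sets of
-- the copies, and it is closed iff each piece is even at its inner vertices, the two pieces meeting
-- at a glued corner have equal degree parity there, and the three outer corners are even.  So the
-- sums F_n(pL, pT, pR) over edge sets with prescribed corner parities and even inner vertices obey a
-- cubic recursion, summing over the parities at the three glue points.  Only two values are nonzero: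
-- X_n (all corners even, i.e. Γ^cl_n) and Y_n (two odd corners), and X' = X³ + Y³, Y' = X Y² + Y³.
-- On Ω_2, X = (1+c)(1+ab)(P − Q) and Y = Q (1+c)(1+ab) with Q = (a+bc)(b+ac) and P the numerator of
-- ψ_3, so X = Y (ψ_3 − 1).  The recursion preserves X = Y (ψ − 1) with ψ ↦ ψ² − 3ψ + 4 and sends Y to
-- Y³ ψ, which unwinds to the product formula.

module Submission where

open import Defs
open import Level using (Level)
open import Data.Nat using (ℕ; _≤_; _∸_; zero; suc; z≤n; s≤s)
import Data.Nat as ℕ
import Data.Nat.Properties as ℕ
open import Algebra.Bundles using (CommutativeRing)
open import Data.Bool.Base using (Bool; true; false; _∧_; if_then_else_)
open import Data.List.Base using (List; []; _∷_; _++_; map; foldr; length; applyUpTo; _∷ʳ_)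
import Data.List.Properties as List
open import Data.List.Relation.Unary.All using (All; []; _∷_)
open import Data.Fin using (#_)
open import Data.Vec.Base using ([]; _∷_)
open import Data.Product.Base using (_,_)
open import Function.Base using (_∘_)
open import Relation.Binary.PropositionalEquality as ≡ using (_≡_)

module IntegerCoefficientSolver {c ℓ : Level} (R : CommutativeRing c ℓ) where
  open import Data.Integer.Base as ℤ using (ℤ; +_; -[1+_])
  import Data.Integer.Properties as ℤ
  open import Data.Sign.Base as Sign using (Sign)
  open import Data.Sum.Base using (inj₁; inj₂)
  open import Data.Maybe.Base using (Maybe; just; nothing)
  open import Relation.Nullary using (yes; no)
  open CommutativeRing R
  open import Algebra.Properties.Semiring.Mult.TCOptimised semiring using (_×_; ×-homo-+; ×1-homo-*)
  open import Algebra.Properties.Ring ring using (-1*x≈-x)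
  open import Algebra.Properties.AbelianGroup +-abelianGroup
    using (⁻¹-∙-comm; ⁻¹-involutive; ε⁻¹≈ε; //-rightDividesʳ; ⁻¹-anti-homo‿-; xyx⁻¹≈y)
  open import Algebra.Properties.CommutativeSemigroup *-commutativeSemigroup using (interchange)
  import Algebra.Solver.Ring.AlmostCommutativeRing as ACR
  open import Relation.Binary.Reasoning.Setoid setoid

  -- With the tail-call optimised multiplication 0 × 1# and 1 × 1# reduce to 0# and 1#: 0-homo and
  -- 1-homo hold by refl, and constant polynomials evaluate to 0# and 1# on the nose.
  ⟦_⟧ℤ : ℤ → Carrier
  ⟦ + n ⟧ℤ      = n × 1#
  ⟦ -[1+ n ] ⟧ℤ = - (suc n × 1#)

  private
    ×1-cong : ∀ {m n} → m ≡ n → m × 1# ≈ n × 1#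
    ×1-cong ≡.refl = refl

    ⟦⊖⟧ : ∀ m n → ⟦ m ℤ.⊖ n ⟧ℤ ≈ m × 1# - n × 1#
    ⟦⊖⟧ m n with ℕ.≤-total n m
    ... | inj₁ n≤m rewrite ℤ.⊖-≥ n≤m = sym (begin
      m × 1# - n × 1#                  ≈⟨ +-congʳ (×1-cong (≡.sym (ℕ.m∸n+n≡m n≤m))) ⟩
      ((m ℕ.∸ n) ℕ.+ n) × 1# - n × 1#  ≈⟨ +-congʳ (×-homo-+ 1# (m ℕ.∸ n) n) ⟩
      (m ℕ.∸ n) × 1# + n × 1# - n × 1# ≈⟨ //-rightDividesʳ (n × 1#) _ ⟩
      (m ℕ.∸ n) × 1#                   ∎)
    ... | inj₂ m≤n rewrite ℤ.⊖-≤ m≤n = begin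
      ⟦ ℤ.- (+ (n ℕ.∸ m)) ⟧ℤ               ≈⟨ ⟦-+⟧ (n ℕ.∸ m) ⟩
      - ((n ℕ.∸ m) × 1#)                   ≈⟨ -‿cong (xyx⁻¹≈y (m × 1#) _) ⟨
      - (m × 1# + (n ℕ.∸ m) × 1# - m × 1#) ≈⟨ ⁻¹-anti-homo‿- _ (m × 1#) ⟩
      m × 1# - (m × 1# + (n ℕ.∸ m) × 1#)   ≈⟨ +-congˡ (-‿cong (×-homo-+ 1# m (n ℕ.∸ m))) ⟨
      m × 1# - (m ℕ.+ (n ℕ.∸ m)) × 1#      ≈⟨ +-congˡ (-‿cong (×1-cong (ℕ.m+[n∸m]≡n m≤n))) ⟩
      m × 1# - n × 1#                      ∎
      where
      ⟦-+⟧ : ∀ k → ⟦ ℤ.- (+ k) ⟧ℤ ≈ - (k × 1#)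
      ⟦-+⟧ zero    = sym ε⁻¹≈ε
      ⟦-+⟧ (suc k) = refl

    ⟦_⟧ₛ : Sign → Carrier
    ⟦ Sign.+ ⟧ₛ = 1#
    ⟦ Sign.- ⟧ₛ = - 1#

    ⟦◃⟧ : ∀ s n → ⟦ s ℤ.◃ n ⟧ℤ ≈ ⟦ s ⟧ₛ * (n × 1#)
    ⟦◃⟧ s       zero    = sym (zeroʳ _)
    ⟦◃⟧ Sign.+ (suc n) = sym (*-identityˡ _)
    ⟦◃⟧ Sign.- (suc n) = sym (-1*x≈-x _)

    sign-abs : ∀ i → ⟦ i ⟧ℤ ≈ ⟦ ℤ.sign i ⟧ₛ * (ℤ.∣ i ∣ × 1#)
    sign-abs (+ n)      = sym (*-identityˡ _)
    sign-abs -[1+ n ]   = sym (-1*x≈-x _)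

    ⟦*⟧ₛ : ∀ s t → ⟦ s Sign.* t ⟧ₛ ≈ ⟦ s ⟧ₛ * ⟦ t ⟧ₛ
    ⟦*⟧ₛ Sign.+ t      = sym (*-identityˡ _)
    ⟦*⟧ₛ Sign.- Sign.+ = sym (*-identityʳ _)
    ⟦*⟧ₛ Sign.- Sign.- = sym (trans (-1*x≈-x (- 1#)) (⁻¹-involutive 1#))

  +-homoℤ : ∀ i j → ⟦ i ℤ.+ j ⟧ℤ ≈ ⟦ i ⟧ℤ + ⟦ j ⟧ℤ
  +-homoℤ (+ m)    (+ n)    = ×-homo-+ 1# m n
  +-homoℤ (+ m)    -[1+ n ] = ⟦⊖⟧ m (suc n)
  +-homoℤ -[1+ m ] (+ n)    = trans (⟦⊖⟧ n (suc m)) (+-comm _ _)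
  +-homoℤ -[1+ m ] -[1+ n ] = begin
    - (suc (suc (m ℕ.+ n)) × 1#) ≈⟨ -‿cong (×1-cong (≡.cong suc (ℕ.+-suc m n))) ⟨
    - ((suc m ℕ.+ suc n) × 1#)   ≈⟨ -‿cong (×-homo-+ 1# (suc m) (suc n)) ⟩
    - (suc m × 1# + suc n × 1#)  ≈⟨ ⁻¹-∙-comm _ _ ⟨
    - (suc m × 1#) + - (suc n × 1#) ∎

  *-homoℤ : ∀ i j → ⟦ i ℤ.* j ⟧ℤ ≈ ⟦ i ⟧ℤ * ⟦ j ⟧ℤ
  *-homoℤ i j = begin
    ⟦ (ℤ.sign i Sign.* ℤ.sign j) ℤ.◃ (ℤ.∣ i ∣ ℕ.* ℤ.∣ j ∣) ⟧ℤ
      ≈⟨ ⟦◃⟧ (ℤ.sign i Sign.* ℤ.sign j) (ℤ.∣ i ∣ ℕ.* ℤ.∣ j ∣) ⟩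
    ⟦ ℤ.sign i Sign.* ℤ.sign j ⟧ₛ * ((ℤ.∣ i ∣ ℕ.* ℤ.∣ j ∣) × 1#)
      ≈⟨ *-cong (⟦*⟧ₛ (ℤ.sign i) (ℤ.sign j)) (×1-homo-* ℤ.∣ i ∣ ℤ.∣ j ∣) ⟩
    (⟦ ℤ.sign i ⟧ₛ * ⟦ ℤ.sign j ⟧ₛ) * ((ℤ.∣ i ∣ × 1#) * (ℤ.∣ j ∣ × 1#))
      ≈⟨ interchange _ _ _ _ ⟩
    (⟦ ℤ.sign i ⟧ₛ * (ℤ.∣ i ∣ × 1#)) * (⟦ ℤ.sign j ⟧ₛ * (ℤ.∣ j ∣ × 1#))
      ≈⟨ *-cong (sign-abs i) (sign-abs j) ⟨
    ⟦ i ⟧ℤ * ⟦ j ⟧ℤ ∎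

  -‿homoℤ : ∀ i → ⟦ ℤ.- i ⟧ℤ ≈ - ⟦ i ⟧ℤ
  -‿homoℤ (+ zero)  = sym ε⁻¹≈ε
  -‿homoℤ (+ suc n) = refl
  -‿homoℤ -[1+ n ]  = sym (⁻¹-involutive _)

  ℤ⟶R : ℤ.+-*-rawRing ACR.-Raw-AlmostCommutative⟶ ACR.fromCommutativeRing R
  ℤ⟶R = record
    { ⟦_⟧ = ⟦_⟧ℤ ; +-homo = +-homoℤ ; *-homo = *-homoℤ ; -‿homo = -‿homoℤ
    ; 0-homo = refl ; 1-homo = refl }

  private
    _≟ℤ_ : ∀ i j → Maybe (⟦ i ⟧ℤ ≈ ⟦ j ⟧ℤ)
    i ≟ℤ j with i ℤ.≟ j
    ... | yes ≡.refl = just refl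
    ... | no _       = nothing

  open import Algebra.Solver.Ring ℤ.+-*-rawRing (ACR.fromCommutativeRing R) ℤ⟶R _≟ℤ_ public

module ParityConditions where
  open import Data.Nat.Base using (_+_; _<_; _%_)
  open import Data.Empty using (⊥-elim)
  open import Data.Nat.Properties
    using (_≟_; _<?_; +-assoc; +-cancelˡ-≡; m≤m+n; <-≤-trans; ≤-trans; <-irrefl; +-monoʳ-<)
  open import Data.Bool.Base using (_∨_; not; _xor_; T)
  open import Data.Bool.Properties
    using (T-∧; not-involutive; not-distribˡ-xor; xor-assoc; xor-identityʳ; ∧-identityʳ; ∧-zeroʳ; ∨-identityʳ)
  open import Data.List.Base using (upTo)
  open import Data.List.Relation.Unary.All using (all?)
  open import Data.Product.Base using (_×_; proj₁; proj₂)
  open import Function.Base using (id)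
  open import Function.Bundles using (_⇔_; mk⇔; Equivalence)
  open Equivalence using (to; from)
  open import Relation.Binary.PropositionalEquality
  open import Relation.Nullary.Decidable
    using (⌊_⌋; isYes≗does; dec-true; dec-false; does-⇔; T?; toWitness; yes; no; _×-dec_)

  infix  4 _==_
  infixr 5 _xnor_

  _==_ : ℕ → ℕ → Bool
  u == v = ⌊ u ≟ v ⌋

  _xnor_ : Bool → Bool → Bool
  a xnor b = not (a xor b)

  ==-refl : ∀ u → (u == u) ≡ true
  ==-refl u = trans (isYes≗does (u ≟ u)) (dec-true (u ≟ u) refl)

  ≢⇒==-false : ∀ {u v} → u ≢ v → (u == v) ≡ false
  ≢⇒==-false {u} {v} u≢v = trans (isYes≗does (u ≟ v)) (dec-false (u ≟ v) u≢v)

  ==-⇔ : ∀ {u v u′ v′} → (u ≡ v ⇔ u′ ≡ v′) → (u == v) ≡ (u′ == v′)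
  ==-⇔ {u} {v} {u′} {v′} eq⇔eq′ =
    trans (isYes≗does (u ≟ v)) (trans (does-⇔ eq⇔eq′ (u ≟ v) (u′ ≟ v′)) (sym (isYes≗does (u′ ≟ v′))))

  ==-sym : ∀ u v → (u == v) ≡ (v == u)
  ==-sym u v = ==-⇔ (mk⇔ sym sym)

  ==-cancelˡ : ∀ k u v → (k + u == k + v) ≡ (u == v)
  ==-cancelˡ k u v = ==-⇔ (mk⇔ (+-cancelˡ-≡ k _ _) (cong (k +_)))

  <⇒≢+ : ∀ {u n} k → u < n → u ≢ n + k
  <⇒≢+ {n = n} k u<n u≡n+k = <-irrefl u≡n+k (<-≤-trans u<n (m≤m+n n k))

  <⇒==+-false : ∀ {u n} k → u < n → (u == n + k) ≡ false
  <⇒==+-false k u<n = ≢⇒==-false (<⇒≢+ k u<n)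

  <⇒+==-false : ∀ {u n} k → u < n → (n + k == u) ≡ false
  <⇒+==-false {u} {n} k u<n = trans (==-sym (n + k) u) (<⇒==+-false k u<n)

  T-⇔⇒≡ : ∀ {a b} → T a ⇔ T b → a ≡ b
  T-⇔⇒≡ {a} {b} a⇔b = does-⇔ a⇔b (T? a) (T? b)

  T-allB : ∀ p n → T (allB p (upTo n)) ⇔ (∀ i → i < n → T (p i))
  T-allB p n = mk⇔ (all-at (λ i → i) n) (all-from (λ i → i) n)
    where
    all-at : ∀ f n → T (allB p (applyUpTo f n)) → ∀ i → i < n → T (p (f i))
    all-at f (suc n) all-p i i<n with p (f 0) in eq
    all-at f (suc n) all-p zero    _         | true = subst T (sym eq) _
    all-at f (suc n) all-p (suc i) (s≤s i<n) | true = all-at (f ∘ suc) n all-p i i<n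
    all-from : ∀ f n → (∀ i → i < n → T (p (f i))) → T (allB p (applyUpTo f n))
    all-from f zero    _ = _
    all-from f (suc n) h with p (f 0) in eq
    ... | true  = all-from (f ∘ suc) n (λ i i<n → h (suc i) (s≤s i<n))
    ... | false = subst T eq (h 0 (s≤s z≤n))

  allB-cong : ∀ {p q} → (∀ v → p v ≡ q v) → ∀ vs → allB p vs ≡ allB q vs
  allB-cong p≗q []       = refl
  allB-cong p≗q (v ∷ vs) = cong₂ (if_then_else false) (p≗q v) (allB-cong p≗q vs)

  allB-applyUpTo-+ : ∀ (p : ℕ → Bool) (f : ℕ → ℕ) m n →
    allB p (applyUpTo f (m + n)) ≡ allB p (applyUpTo f m) ∧ allB p (applyUpTo (λ i → f (m + i)) n)
  allB-applyUpTo-+ p f zero    n = refl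
  allB-applyUpTo-+ p f (suc m) n with p (f 0)
  ... | true  = allB-applyUpTo-+ p (f ∘ suc) m n
  ... | false = refl

  allB-applyUpTo : ∀ (p : ℕ → Bool) (f g : ℕ → ℕ) n →
    allB p (applyUpTo (λ i → f (g i)) n) ≡ allB (λ i → p (f i)) (applyUpTo g n)
  allB-applyUpTo p f g zero    = refl
  allB-applyUpTo p f g (suc n) = cong (if p (f (g 0)) then_else false) (allB-applyUpTo p f (g ∘ suc) n)

  oddCount : (ℕ → Bool) → List Edge → Bool
  oddCount p []              = false
  oddCount p ((x , y , _) ∷ es) = (p x xor p y) xor oddCount p es

  oddAt : List Edge → ℕ → Bool
  oddAt X v = oddCount (_== v) X

  oddCount-map : ∀ p f X → oddCount p (map (mapEdge f) X) ≡ oddCount (p ∘ f) X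
  oddCount-map p f []              = refl
  oddCount-map p f ((x , y , _) ∷ es) = cong ((p (f x) xor p (f y)) xor_) (oddCount-map p f es)

  oddCount-++ : ∀ p X Y → oddCount p (X ++ Y) ≡ oddCount p X xor oddCount p Y
  oddCount-++ p []              Y = refl
  oddCount-++ p ((x , y , _) ∷ es) Y =
    trans (cong ((p x xor p y) xor_) (oddCount-++ p es Y)) (sym (xor-assoc (p x xor p y) _ _))

  oddCount-false : ∀ X → oddCount (λ _ → false) X ≡ false
  oddCount-false []           = refl
  oddCount-false (_ ∷ es)     = oddCount-false es

  oddCount-∧ : ∀ b p X → oddCount (λ u → b ∧ p u) X ≡ b ∧ oddCount p X
  oddCount-∧ true  p X = refl
  oddCount-∧ false p X = oddCount-false X

  EdgeBelow : ℕ → Edge → Set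
  EdgeBelow n (x , y , _) = x < n × y < n

  oddCount-cong : ∀ {n} p q X → All (EdgeBelow n) X → (∀ u → u < n → p u ≡ q u) →
                  oddCount p X ≡ oddCount q X
  oddCount-cong p q []              []                 p≗q = refl
  oddCount-cong p q ((x , y , _) ∷ es) ((x<n , y<n) ∷ below) p≗q =
    cong₂ _xor_ (cong₂ _xor_ (p≗q x x<n) (p≗q y y<n)) (oddCount-cong p q es below p≗q)

  odd : ℕ → Bool
  odd zero    = false
  odd (suc n) = not (odd n)

  odd-+ : ∀ m n → odd (m + n) ≡ odd m xor odd n
  odd-+ zero    n = refl
  odd-+ (suc m) n = trans (cong not (odd-+ m n)) (not-distribˡ-xor (odd m) (odd n))

  odd-indicator : ∀ b → odd (if b then 1 else 0) ≡ b
  odd-indicator true  = refl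
  odd-indicator false = refl

  odd-deg : ∀ v X → odd (deg v X) ≡ oddAt X v
  odd-deg v []              = refl
  odd-deg v ((x , y , _) ∷ es) =
    trans (odd-+ ((if x == v then 1 else 0) + (if y == v then 1 else 0)) (deg v es))
          (cong₂ _xor_ (trans (odd-+ (if x == v then 1 else 0) _)
                              (cong₂ _xor_ (odd-indicator (x == v)) (odd-indicator (y == v))))
                       (odd-deg v es))

  ⌊%2≟0⌋≡not-odd : ∀ n → ⌊ n % 2 ≟ 0 ⌋ ≡ not (odd n)
  ⌊%2≟0⌋≡not-odd zero          = refl
  ⌊%2≟0⌋≡not-odd (suc zero)    = refl
  ⌊%2≟0⌋≡not-odd (suc (suc n)) = trans (⌊%2≟0⌋≡not-odd n) (cong not (sym (not-involutive (odd n))))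

  even-deg : ∀ v X → ⌊ deg v X % 2 ≟ 0 ⌋ ≡ not (oddAt X v)
  even-deg v X = trans (⌊%2≟0⌋≡not-odd (deg v X)) (cong not (odd-deg v X))

  record WellFormed (G : LGraph) : Set where
    field
      L<n     : cL G < nv G
      T<n     : cT G < nv G
      R<n     : cR G < nv G
      L≢T     : cL G ≢ cT G
      L≢R     : cL G ≢ cR G
      T≢R     : cT G ≢ cR G
      edges<n : All (EdgeBelow (nv G)) (edges G)

  isCorner : LGraph → ℕ → Bool
  isCorner G v = (v == cL G) ∨ ((v == cT G) ∨ (v == cR G))

  innerEven : LGraph → List Edge → Bool
  innerEven G X = allB (λ v → isCorner G v ∨ not (oddAt X v)) (upTo (nv G))

  -- pL, pT, pR are the prescribed degree parities (true = odd) at the corners L, T, R.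
  hasParities : LGraph → Bool → Bool → Bool → List Edge → Bool
  hasParities G pL pT pR X =
    (oddAt X (cL G) xnor pL) ∧ ((oddAt X (cT G) xnor pT) ∧ ((oddAt X (cR G) xnor pR) ∧ innerEven G X))

  module Corners (G : LGraph) (wf : WellFormed G) where
    open WellFormed wf
    private
      N = nv G
      L = cL G
      Tc = cT G
      R = cR G

    NonCorner : ℕ → Set
    NonCorner v = v ≢ L × v ≢ Tc × v ≢ R

    isCorner-noncorner : ∀ {v} → NonCorner v → isCorner G v ≡ false
    isCorner-noncorner (v≢L , v≢T , v≢R)
      rewrite ≢⇒==-false v≢L | ≢⇒==-false v≢T | ≢⇒==-false v≢R = refl

    T-innerEven : ∀ X → T (innerEven G X) ⇔ (∀ v → v < N → NonCorner v → T (not (oddAt X v)))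
    T-innerEven X = mk⇔
      (λ t v v<N nc → subst (λ b → T (b ∨ not (oddAt X v))) (isCorner-noncorner nc)
                            (to (T-allB _ N) t v v<N))
      (λ h → from (T-allB _ N) (λ v v<N → corner-or-even v v<N (h v v<N)))
      where
      corner-or-even : ∀ v → v < N → (NonCorner v → T (not (oddAt X v))) → T (isCorner G v ∨ not (oddAt X v))
      corner-or-even v v<N h with v ≟ L | v ≟ Tc | v ≟ R
      ... | yes _  | _      | _      = _
      ... | no _   | yes _  | _      = _
      ... | no _   | no _   | yes _  = _
      ... | no v≢L | no v≢T | no v≢R = h (v≢L , v≢T , v≢R)

    allB-corners : ∀ X (f : ℕ → Bool) → (∀ v → v < N → NonCorner v → f v ≡ not (oddAt X v)) →
                   allB f (upTo N) ≡ f L ∧ (f Tc ∧ (f R ∧ innerEven G X))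
    allB-corners X f f-off = T-⇔⇒≡ (mk⇔ forward backward)
      where
      forward : T (allB f (upTo N)) → T (f L ∧ (f Tc ∧ (f R ∧ innerEven G X)))
      forward t = from T-∧ (all-f L L<n , from T-∧ (all-f Tc T<n , from T-∧ (all-f R R<n ,
               from (T-innerEven X) (λ v v<N nc → subst T (f-off v v<N nc) (all-f v v<N)))))
        where
        all-f : ∀ v → v < N → T (f v)
        all-f = to (T-allB f N) t
      backward : T (f L ∧ (f Tc ∧ (f R ∧ innerEven G X))) → T (allB f (upTo N))
      backward t = from (T-allB f N) all-f
        where
        fL×rest = to T-∧ t
        fT×rest = to T-∧ (proj₂ fL×rest)
        fR×inner = to T-∧ (proj₂ fT×rest)
        all-f : ∀ v → v < N → T (f v)
        all-f v v<N with v ≟ L | v ≟ Tc | v ≟ R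
        ... | yes refl | _        | _        = proj₁ fL×rest
        ... | no _     | yes refl | _        = proj₁ fT×rest
        ... | no _     | no _     | yes refl = proj₁ fR×inner
        ... | no v≢L   | no v≢T   | no v≢R   =
          subst T (sym (f-off v v<N (v≢L , v≢T , v≢R))) (to (T-innerEven X) (proj₂ fR×inner) v v<N (v≢L , v≢T , v≢R))

    not≡xnor-false : ∀ b → not b ≡ b xnor false
    not≡xnor-false b = cong not (sym (xor-identityʳ b))

    isClosed≡hasParities-even : ∀ X → isClosed G X ≡ hasParities G false false false X
    isClosed≡hasParities-even X = begin
      isClosed G X
        ≡⟨ allB-cong (λ v → even-deg v X) (upTo N) ⟩
      allB (not ∘ oddAt X) (upTo N)
        ≡⟨ allB-corners X (not ∘ oddAt X) (λ _ _ _ → refl) ⟩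
      not (oddAt X L) ∧ (not (oddAt X Tc) ∧ (not (oddAt X R) ∧ innerEven G X))
        ≡⟨ cong₂ _∧_ (not≡xnor-false (oddAt X L))
             (cong₂ _∧_ (not≡xnor-false (oddAt X Tc)) (cong (_∧ innerEven G X) (not≡xnor-false (oddAt X R)))) ⟩
      hasParities G false false false X ∎
      where open ≡-Reasoning

  rn-other : ∀ {from to v} → (v == from) ≡ false → rn from to v ≡ v
  rn-other {from} {to} {v} = cong (if_then to else v)

  rn-hit : ∀ {from to v} → (v == from) ≡ true → rn from to v ≡ to
  rn-hit {from} {to} {v} = cong (if_then to else v)

  module Gluing (G : LGraph) (wf : WellFormed G) where
    open WellFormed wf
    private
      N = nv G
      L = cL G
      Tc = cT G
      R = cR G

    -- Copies 1, 2, 3 of G (bottom-left, bottom-right, top) have their vertex ids shifted by 0, N, 2N;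
    -- glue is the identification of corners performed by step.
    glue : ℕ → ℕ
    glue v = rn (N + L) R (rn (N + N + L) Tc (rn (N + N + R) (N + Tc) v))

    private
      <⇒<N+N : ∀ {u} → u < N → u < N + N
      <⇒<N+N u<N = <-≤-trans u<N (m≤m+n N N)

      N+N+u==N+v-false : ∀ u {v} → v < N → (N + N + u == N + v) ≡ false
      N+N+u==N+v-false u {v} v<N =
        trans (cong (_== N + v) (+-assoc N N u)) (trans (==-cancelˡ N (N + u) _) (<⇒+==-false u v<N))

      N+v==N+N+u-false : ∀ u {v} → v < N → (N + v == N + N + u) ≡ false
      N+v==N+N+u-false u {v} v<N = trans (==-sym (N + v) (N + N + u)) (N+N+u==N+v-false u v<N)

    glue-copy₁ : ∀ {u} → u < N → glue u ≡ u
    glue-copy₁ u<N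
      rewrite rn-other {N + N + R} {N + Tc} (<⇒==+-false R (<⇒<N+N u<N))
            | rn-other {N + N + L} {Tc} (<⇒==+-false L (<⇒<N+N u<N))
            | rn-other {N + L} {R} (<⇒==+-false L u<N) = refl

    glue-copy₂ : ∀ {u} → u < N → glue (N + u) ≡ (if u == L then R else N + u)
    glue-copy₂ {u} u<N
      rewrite rn-other {N + N + R} {N + Tc} (N+v==N+N+u-false R u<N)
            | rn-other {N + N + L} {Tc} (N+v==N+N+u-false L u<N)
            | ==-cancelˡ N u L = refl

    glue-copy₃ : ∀ {u} → u < N → glue (N + N + u) ≡ (if u == L then Tc else if u == R then N + Tc else N + N + u)
    glue-copy₃ {u} u<N with u ≟ R | u ≟ L
    ... | yes refl | yes R≡L = ⊥-elim (L≢R (sym R≡L))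
    ... | yes refl | no _
      rewrite rn-hit {N + N + R} {N + Tc} {N + N + R} (==-refl (N + N + R))
            | rn-other {N + N + L} {Tc} (N+v==N+N+u-false L T<n)
            | ==-cancelˡ N Tc L | ≢⇒==-false (L≢T ∘ sym) = refl
    ... | no _ | yes refl
      rewrite rn-other {N + N + R} {N + Tc} {N + N + L} (trans (==-cancelˡ (N + N) L R) (≢⇒==-false L≢R))
            | rn-hit {N + N + L} {Tc} {N + N + L} (==-refl (N + N + L))
            | <⇒==+-false {Tc} L T<n = refl
    ... | no u≢R | no u≢L
      rewrite rn-other {N + N + R} {N + Tc} {N + N + u} (trans (==-cancelˡ (N + N) u R) (≢⇒==-false u≢R))
            | rn-other {N + N + L} {Tc} {N + N + u} (trans (==-cancelˡ (N + N) u L) (≢⇒==-false u≢L))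
            | N+N+u==N+v-false u L<n = refl

    glue₁==₁ : ∀ {u} v → u < N → (glue u == v) ≡ (u == v)
    glue₁==₁ v u<N rewrite glue-copy₁ u<N = refl

    glue₂==₁ : ∀ {u v} → u < N → v < N → (glue (N + u) == v) ≡ (R == v) ∧ (u == L)
    glue₂==₁ {u} {v} u<N v<N rewrite glue-copy₂ u<N with u == L
    ... | true  = sym (∧-identityʳ _)
    ... | false = trans (<⇒+==-false u v<N) (sym (∧-zeroʳ _))

    glue₃==₁ : ∀ {u v} → u < N → v < N → (glue (N + N + u) == v) ≡ (Tc == v) ∧ (u == L)
    glue₃==₁ {u} {v} u<N v<N rewrite glue-copy₃ u<N with u == L
    ... | true = sym (∧-identityʳ _)
    ... | false with u == R
    ...   | true  = trans (<⇒+==-false Tc v<N) (sym (∧-zeroʳ _))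
    ...   | false = trans (<⇒+==-false u (<⇒<N+N v<N)) (sym (∧-zeroʳ _))

    glue₁==₂ : ∀ {u} v → u < N → (glue u == N + v) ≡ false
    glue₁==₂ v u<N rewrite glue-copy₁ u<N = <⇒==+-false v u<N

    glue₂==₂ : ∀ {u v} → u < N → v < N → (glue (N + u) == N + v) ≡ not (v == L) ∧ (u == v)
    glue₂==₂ {u} {v} u<N v<N rewrite glue-copy₂ u<N with u ≟ L | u ≟ v
    ... | yes refl | yes refl rewrite ==-refl L = <⇒==+-false L R<n
    ... | yes refl | no _     rewrite <⇒==+-false v R<n = sym (∧-zeroʳ _)
    ... | no u≢L   | yes refl rewrite ≢⇒==-false u≢L | ==-cancelˡ N u u | ==-refl u = refl
    ... | no _     | no u≢v   rewrite ==-cancelˡ N u v | ≢⇒==-false u≢v = sym (∧-zeroʳ _)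

    glue₃==₂ : ∀ {u v} → u < N → v < N → (glue (N + N + u) == N + v) ≡ (Tc == v) ∧ (u == R)
    glue₃==₂ {u} {v} u<N v<N rewrite glue-copy₃ u<N with u ≟ L
    ... | yes refl rewrite <⇒==+-false v T<n | ≢⇒==-false L≢R = sym (∧-zeroʳ _)
    ... | no _ with u == R
    ...   | true  = trans (==-cancelˡ N Tc v) (sym (∧-identityʳ _))
    ...   | false = trans (N+N+u==N+v-false u v<N) (sym (∧-zeroʳ _))

    glue₁==₃ : ∀ {u} v → u < N → (glue u == N + N + v) ≡ false
    glue₁==₃ v u<N rewrite glue-copy₁ u<N | +-assoc N N v = <⇒==+-false (N + v) u<N

    glue₂==₃ : ∀ {u v} → u < N → v < N → (glue (N + u) == N + N + v) ≡ false
    glue₂==₃ {u} {v} u<N v<N rewrite glue-copy₂ u<N with u == L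
    ... | true rewrite +-assoc N N v = <⇒==+-false (N + v) R<n
    ... | false = N+v==N+N+u-false v u<N

    glue₃==₃ : ∀ {u v} → u < N → v < N →
               (glue (N + N + u) == N + N + v) ≡ (not (v == L) ∧ not (v == R)) ∧ (u == v)
    glue₃==₃ {u} {v} u<N v<N rewrite glue-copy₃ u<N with u ≟ L | u ≟ R | u ≟ v
    ... | yes refl | yes L≡R  | _        = ⊥-elim (L≢R L≡R)
    ... | yes refl | no _     | yes refl rewrite ==-refl L | +-assoc N N v = <⇒==+-false (N + v) T<n
    ... | yes refl | no _     | no _     rewrite +-assoc N N v | <⇒==+-false {Tc} (N + v) T<n = sym (∧-zeroʳ _)
    ... | no _     | yes refl | yes refl rewrite ==-refl R | ∧-zeroʳ (not (R == L)) = N+v==N+N+u-false v T<n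
    ... | no _     | yes refl | no _     rewrite N+v==N+N+u-false v T<n = sym (∧-zeroʳ _)
    ... | no u≢L   | no u≢R   | yes refl
      rewrite ==-cancelˡ (N + N) u u | ==-refl u | ≢⇒==-false u≢L | ≢⇒==-false u≢R = refl
    ... | no _     | no _     | no u≢v   rewrite ==-cancelˡ (N + N) u v | ≢⇒==-false u≢v = sym (∧-zeroʳ _)

    shift : ℕ → List Edge → List Edge
    shift k = map (mapEdge (k +_))

    glued : List Edge → List Edge → List Edge → List Edge
    glued X₁ X₂ X₃ = map (mapEdge glue) (shift 0 X₁ ++ (shift N X₂ ++ shift (N + N) X₃))

    oddAt-glued : ∀ X₁ X₂ X₃ v → oddAt (glued X₁ X₂ X₃) v ≡
      oddCount (λ u → glue u == v) X₁ xor
        (oddCount (λ u → glue (N + u) == v) X₂ xor oddCount (λ u → glue (N + N + u) == v) X₃)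
    oddAt-glued X₁ X₂ X₃ v =
      trans (oddCount-map (_== v) glue (shift 0 X₁ ++ (shift N X₂ ++ shift (N + N) X₃)))
      (trans (oddCount-++ _ (shift 0 X₁) (shift N X₂ ++ shift (N + N) X₃))
      (cong₂ _xor_ (oddCount-map (λ u → glue u == v) (0 +_) X₁)
         (trans (oddCount-++ _ (shift N X₂) (shift (N + N) X₃))
            (cong₂ _xor_ (oddCount-map (λ u → glue u == v) (N +_) X₂)
                         (oddCount-map (λ u → glue u == v) ((N + N) +_) X₃)))))

    compatible : List Edge → List Edge → List Edge → Bool
    compatible X₁ X₂ X₃ =
      (((oddAt X₁ Tc xnor oddAt X₃ L) ∧ ((oddAt X₁ R xnor oddAt X₂ L) ∧ innerEven G X₁)) ∧
       ((oddAt X₂ Tc xnor oddAt X₃ R) ∧ innerEven G X₂)) ∧ innerEven G X₃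

    module _ {X₁ X₂ X₃ : List Edge} (X₁<N : All (EdgeBelow N) X₁) (X₂<N : All (EdgeBelow N) X₂)
             (X₃<N : All (EdgeBelow N) X₃) where

      oddAt-glued₁ : ∀ {v} → v < N → oddAt (glued X₁ X₂ X₃) v ≡
        oddAt X₁ v xor (((R == v) ∧ oddAt X₂ L) xor ((Tc == v) ∧ oddAt X₃ L))
      oddAt-glued₁ {v} v<N = trans (oddAt-glued X₁ X₂ X₃ v)
        (cong₂ _xor_ (oddCount-cong _ _ X₁ X₁<N (λ u u<N → glue₁==₁ v u<N))
          (cong₂ _xor_
            (trans (oddCount-cong _ _ X₂ X₂<N (λ u u<N → glue₂==₁ u<N v<N)) (oddCount-∧ (R == v) (_== L) X₂))
            (trans (oddCount-cong _ _ X₃ X₃<N (λ u u<N → glue₃==₁ u<N v<N)) (oddCount-∧ (Tc == v) (_== L) X₃))))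

      oddAt-glued₂ : ∀ {v} → v < N → oddAt (glued X₁ X₂ X₃) (N + v) ≡
        (not (v == L) ∧ oddAt X₂ v) xor ((Tc == v) ∧ oddAt X₃ R)
      oddAt-glued₂ {v} v<N = trans (oddAt-glued X₁ X₂ X₃ (N + v))
        (cong₂ _xor_ (trans (oddCount-cong _ _ X₁ X₁<N (λ u u<N → glue₁==₂ v u<N)) (oddCount-false X₁))
          (cong₂ _xor_
            (trans (oddCount-cong _ _ X₂ X₂<N (λ u u<N → glue₂==₂ u<N v<N)) (oddCount-∧ (not (v == L)) (_== v) X₂))
            (trans (oddCount-cong _ _ X₃ X₃<N (λ u u<N → glue₃==₂ u<N v<N)) (oddCount-∧ (Tc == v) (_== R) X₃))))

      oddAt-glued₃ : ∀ {v} → v < N → oddAt (glued X₁ X₂ X₃) (N + N + v) ≡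
        (not (v == L) ∧ not (v == R)) ∧ oddAt X₃ v
      oddAt-glued₃ {v} v<N = trans (oddAt-glued X₁ X₂ X₃ (N + N + v))
        (cong₂ _xor_ (trans (oddCount-cong _ _ X₁ X₁<N (λ u u<N → glue₁==₃ v u<N)) (oddCount-false X₁))
          (cong₂ _xor_
            (trans (oddCount-cong _ _ X₂ X₂<N (λ u u<N → glue₂==₃ u<N v<N)) (oddCount-false X₂))
            (trans (oddCount-cong _ _ X₃ X₃<N (λ u u<N → glue₃==₃ u<N v<N)) (oddCount-∧ _ (_== v) X₃))))

      private
        Xg = glued X₁ X₂ X₃
        d₁ = oddAt X₁
        d₂ = oddAt X₂
        d₃ = oddAt X₃

        evenOff : ℕ → Bool
        evenOff v = isCorner (step G) v ∨ not (oddAt Xg v)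

        evenOff₁ : ∀ {v} → v < N → evenOff v ≡ (v == L) ∨ not (d₁ v xor (((R == v) ∧ d₂ L) xor ((Tc == v) ∧ d₃ L)))
        evenOff₁ {v} v<N
          rewrite <⇒==+-false {v} {N + N} Tc (<⇒<N+N v<N) | <⇒==+-false R v<N
                | oddAt-glued₁ v<N | ∨-identityʳ (v == L) = refl

        evenOff₂ : ∀ {v} → v < N → evenOff (N + v) ≡ (v == R) ∨ not ((not (v == L) ∧ d₂ v) xor ((Tc == v) ∧ d₃ R))
        evenOff₂ {v} v<N
          rewrite <⇒+==-false v L<n | N+v==N+N+u-false Tc v<N | ==-cancelˡ N v R | oddAt-glued₂ v<N = refl

        evenOff₃ : ∀ {v} → v < N → evenOff (N + N + v) ≡ (v == Tc) ∨ not ((not (v == L) ∧ not (v == R)) ∧ d₃ v)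
        evenOff₃ {v} v<N
          rewrite <⇒+==-false {L} {N + N} v (<⇒<N+N L<n) | ==-cancelˡ (N + N) v Tc | N+N+u==N+v-false v R<n
                | oddAt-glued₃ v<N | ∨-identityʳ (v == Tc) = refl

        open Corners G wf using (NonCorner; allB-corners)

        evenOff₁-off : ∀ v → v < N → NonCorner v → evenOff v ≡ not (d₁ v)
        evenOff₁-off v v<N (v≢L , v≢T , v≢R)
          rewrite evenOff₁ v<N | ≢⇒==-false v≢L | ≢⇒==-false (v≢R ∘ sym) | ≢⇒==-false (v≢T ∘ sym)
                | xor-identityʳ (d₁ v) = refl

        evenOff₂-off : ∀ v → v < N → NonCorner v → evenOff (N + v) ≡ not (d₂ v)
        evenOff₂-off v v<N (v≢L , v≢T , v≢R)
          rewrite evenOff₂ v<N | ≢⇒==-false v≢L | ≢⇒==-false v≢R | ≢⇒==-false (v≢T ∘ sym)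
                | xor-identityʳ (d₂ v) = refl

        evenOff₃-off : ∀ v → v < N → NonCorner v → evenOff (N + N + v) ≡ not (d₃ v)
        evenOff₃-off v v<N (v≢L , v≢T , v≢R)
          rewrite evenOff₃ v<N | ≢⇒==-false v≢L | ≢⇒==-false v≢T | ≢⇒==-false v≢R = refl

        corner-values :
          ((evenOff L ∧ (evenOff Tc ∧ (evenOff R ∧ innerEven G X₁))) ∧
           (evenOff (N + L) ∧ (evenOff (N + Tc) ∧ (evenOff (N + R) ∧ innerEven G X₂)))) ∧
          (evenOff (N + N + L) ∧ (evenOff (N + N + Tc) ∧ (evenOff (N + N + R) ∧ innerEven G X₃)))
          ≡ compatible X₁ X₂ X₃
        corner-values
          rewrite evenOff₁ L<n | evenOff₁ T<n | evenOff₁ R<n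
                | evenOff₂ L<n | evenOff₂ T<n | evenOff₂ R<n
                | evenOff₃ L<n | evenOff₃ T<n | evenOff₃ R<n
                | ==-refl L | ==-refl Tc | ==-refl R
                | ≢⇒==-false L≢T | ≢⇒==-false L≢R | ≢⇒==-false T≢R
                | ≢⇒==-false (L≢T ∘ sym) | ≢⇒==-false (L≢R ∘ sym) | ≢⇒==-false (T≢R ∘ sym)
                | xor-identityʳ (d₂ L) = refl

      innerEven-glued : innerEven (step G) Xg ≡ compatible X₁ X₂ X₃
      innerEven-glued = begin
        allB evenOff (upTo (N + N + N))
          ≡⟨ allB-applyUpTo-+ evenOff id (N + N) N ⟩
        allB evenOff (upTo (N + N)) ∧ allB evenOff (applyUpTo (N + N +_) N)
          ≡⟨ cong₂ _∧_ (allB-applyUpTo-+ evenOff id N N) (allB-applyUpTo evenOff (N + N +_) id N) ⟩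
        (allB evenOff (upTo N) ∧ allB evenOff (applyUpTo (N +_) N)) ∧ allB (λ v → evenOff (N + N + v)) (upTo N)
          ≡⟨ cong (λ b → (allB evenOff (upTo N) ∧ b) ∧ allB (λ v → evenOff (N + N + v)) (upTo N))
                  (allB-applyUpTo evenOff (N +_) id N) ⟩
        (allB evenOff (upTo N) ∧ allB (λ v → evenOff (N + v)) (upTo N)) ∧ allB (λ v → evenOff (N + N + v)) (upTo N)
          ≡⟨ cong₂ _∧_ (cong₂ _∧_ (allB-corners X₁ evenOff evenOff₁-off)
                                  (allB-corners X₂ (λ v → evenOff (N + v)) evenOff₂-off))
                       (allB-corners X₃ (λ v → evenOff (N + N + v)) evenOff₃-off) ⟩
        ((evenOff L ∧ (evenOff Tc ∧ (evenOff R ∧ innerEven G X₁))) ∧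
         (evenOff (N + L) ∧ (evenOff (N + Tc) ∧ (evenOff (N + R) ∧ innerEven G X₂)))) ∧
        (evenOff (N + N + L) ∧ (evenOff (N + N + Tc) ∧ (evenOff (N + N + R) ∧ innerEven G X₃)))
          ≡⟨ corner-values ⟩
        compatible X₁ X₂ X₃ ∎
        where open ≡-Reasoning

      hasParities-glued : ∀ pL pT pR → hasParities (step G) pL pT pR Xg ≡
        (d₁ L xnor pL) ∧ ((d₃ Tc xnor pT) ∧ ((d₂ R xnor pR) ∧ compatible X₁ X₂ X₃))
      hasParities-glued pL pT pR
        rewrite oddAt-glued₁ L<n | oddAt-glued₃ T<n | oddAt-glued₂ R<n
              | ≢⇒==-false (L≢R ∘ sym) | ≢⇒==-false (L≢T ∘ sym) | ≢⇒==-false T≢R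
              | xor-identityʳ (d₁ L) | xor-identityʳ (d₂ R) | innerEven-glued = refl

    private
      <3N₁ : ∀ {v} → v < N → v < N + N + N
      <3N₁ v<N = <-≤-trans v<N (≤-trans (m≤m+n N N) (m≤m+n (N + N) N))

      <3N₂ : ∀ {v} → v < N → N + v < N + N + N
      <3N₂ v<N = <-≤-trans (+-monoʳ-< N v<N) (m≤m+n (N + N) N)

      <3N₃ : ∀ {v} → v < N → N + N + v < N + N + N
      <3N₃ v<N = +-monoʳ-< (N + N) v<N

      if-< : ∀ {m} b {x y} → x < m → y < m → (if b then x else y) < m
      if-< true  x<m _ = x<m
      if-< false _ y<m = y<m

      All-glue-shift : ∀ k → (∀ {u} → u < N → glue (k + u) < N + N + N) → ∀ X → All (EdgeBelow N) X →
                       All (EdgeBelow (N + N + N)) (map (mapEdge glue) (shift k X))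
      All-glue-shift k bound []              []                   = []
      All-glue-shift k bound ((x , y , _) ∷ X) ((x<N , y<N) ∷ X<N) = (bound x<N , bound y<N) ∷ All-glue-shift k bound X X<N

      All-map-++ : ∀ {n} (f : Edge → Edge) A B →
                   All (EdgeBelow n) (map f A) → All (EdgeBelow n) (map f B) → All (EdgeBelow n) (map f (A ++ B))
      All-map-++ f []      B _          fB = fB
      All-map-++ f (x ∷ A) B (fx ∷ fA) fB = fx ∷ All-map-++ f A B fA fB

    wellFormed-step : WellFormed (step G)
    wellFormed-step = record
      { L<n = <3N₁ L<n ; T<n = <3N₃ T<n ; R<n = <3N₂ R<n
      ; L≢T = <⇒≢+ Tc (<⇒<N+N L<n)
      ; L≢R = <⇒≢+ R L<n
      ; T≢R = λ eq → <⇒≢+ Tc R<n (sym (+-cancelˡ-≡ N _ _ (trans (sym (+-assoc N N Tc)) eq)))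
      ; edges<n = All-map-++ (mapEdge glue) (shift 0 (edges G)) _
          (All-glue-shift 0 (λ u<N → subst (_< N + N + N) (sym (glue-copy₁ u<N)) (<3N₁ u<N)) (edges G) edges<n)
          (All-map-++ (mapEdge glue) (shift N (edges G)) _
            (All-glue-shift N (λ {u} u<N → subst (_< N + N + N) (sym (glue-copy₂ u<N)) (if-< (u == L) (<3N₁ R<n) (<3N₂ u<N)))
                            (edges G) edges<n)
            (All-glue-shift (N + N) (λ {u} u<N → subst (_< N + N + N) (sym (glue-copy₃ u<N))
                                         (if-< (u == L) (<3N₁ T<n) (if-< (u == R) (<3N₂ T<n) (<3N₃ u<N))))
                            (edges G) edges<n))
      }

  wellFormed-Ω : ∀ k → WellFormed (Ω k)
  wellFormed-Ω zero    = record
    { L<n = s≤s z≤n ; T<n = s≤s (s≤s z≤n) ; R<n = s≤s (s≤s (s≤s z≤n))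
    ; L≢T = λ () ; L≢R = λ () ; T≢R = λ ()
    ; edges<n = toWitness {a? = all? (λ { (x , y , _) → (x <? 6) ×-dec (y <? 6) }) (edges Ω₂)} _ }
  wellFormed-Ω (suc k) = Gluing.wellFormed-step (Ω k) (wellFormed-Ω k)

open ParityConditions

module Sums {c ℓ : Level} (R : CommutativeRing c ℓ) where
  open CommutativeRing R
  open Gen R using (sumR)
  open import Relation.Binary.Reasoning.Setoid setoid
  open import Algebra.Properties.CommutativeSemigroup +-commutativeSemigroup
    using () renaming (interchange to +-interchange)

  Σ[_] : ∀ {A : Set} → List A → (A → Carrier) → Carrier
  Σ[ xs ] f = sumR (map f xs)

  sum-cong : ∀ {A : Set} (xs : List A) {f g : A → Carrier} → (∀ x → f x ≈ g x) → Σ[ xs ] f ≈ Σ[ xs ] g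
  sum-cong []       f≈g = refl
  sum-cong (x ∷ xs) f≈g = +-cong (f≈g x) (sum-cong xs f≈g)

  sum-++ : ∀ {A : Set} (xs ys : List A) (f : A → Carrier) → Σ[ xs ++ ys ] f ≈ Σ[ xs ] f + Σ[ ys ] f
  sum-++ []       ys f = sym (+-identityˡ _)
  sum-++ (x ∷ xs) ys f = trans (+-congˡ (sum-++ xs ys f)) (sym (+-assoc _ _ _))

  sum-map : ∀ {A B : Set} (xs : List A) (g : A → B) (f : B → Carrier) → Σ[ map g xs ] f ≡ Σ[ xs ] (λ x → f (g x))
  sum-map []       g f = ≡.refl
  sum-map (x ∷ xs) g f = ≡.cong (f (g x) +_) (sum-map xs g f)

  sum-+ : ∀ {A : Set} (xs : List A) (f g : A → Carrier) → Σ[ xs ] (λ x → f x + g x) ≈ Σ[ xs ] f + Σ[ xs ] g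
  sum-+ []       f g = sym (+-identityˡ _)
  sum-+ (x ∷ xs) f g = trans (+-congˡ (sum-+ xs f g)) (+-interchange (f x) (g x) _ _)

  sum-*ʳ : ∀ {A : Set} (xs : List A) (f : A → Carrier) k → Σ[ xs ] f * k ≈ Σ[ xs ] (λ x → f x * k)
  sum-*ʳ []       f k = zeroˡ k
  sum-*ʳ (x ∷ xs) f k = trans (distribʳ k (f x) _) (+-congˡ (sum-*ʳ xs f k))

  sum-*ˡ : ∀ {A : Set} (xs : List A) (f : A → Carrier) k → k * Σ[ xs ] f ≈ Σ[ xs ] (λ x → k * f x)
  sum-*ˡ []       f k = zeroʳ k
  sum-*ˡ (x ∷ xs) f k = trans (distribˡ k (f x) _) (+-congˡ (sum-*ˡ xs f k))

  sum³-* : ∀ {A : Set} (xs : List A) (f g h : A → Carrier) →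
    Σ[ xs ] f * Σ[ xs ] g * Σ[ xs ] h ≈ Σ[ xs ] (λ x → Σ[ xs ] (λ y → Σ[ xs ] (λ z → f x * g y * h z)))
  sum³-* xs f g h = begin
    Σ[ xs ] f * Σ[ xs ] g * Σ[ xs ] h                          ≈⟨ *-congʳ (sum-*ʳ xs f _) ⟩
    Σ[ xs ] (λ x → f x * Σ[ xs ] g) * Σ[ xs ] h                ≈⟨ sum-*ʳ xs _ _ ⟩
    Σ[ xs ] (λ x → f x * Σ[ xs ] g * Σ[ xs ] h)                ≈⟨ sum-cong xs (λ x → *-congʳ (sum-*ˡ xs g (f x))) ⟩
    Σ[ xs ] (λ x → Σ[ xs ] (λ y → f x * g y) * Σ[ xs ] h)      ≈⟨ sum-cong xs (λ x → sum-*ʳ xs _ _) ⟩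
    Σ[ xs ] (λ x → Σ[ xs ] (λ y → f x * g y * Σ[ xs ] h))      ≈⟨ sum-cong xs (λ x → sum-cong xs (λ y → sum-*ˡ xs h _)) ⟩
    Σ[ xs ] (λ x → Σ[ xs ] (λ y → Σ[ xs ] (λ z → f x * g y * h z))) ∎

  ΣB : (Bool → Carrier) → Carrier
  ΣB f = f true + f false

  ΣB-cong : ∀ {f g : Bool → Carrier} → (∀ α → f α ≈ g α) → ΣB f ≈ ΣB g
  ΣB-cong f≈g = +-cong (f≈g true) (f≈g false)

  ΣB-sum : ∀ {A : Set} (xs : List A) (f : Bool → A → Carrier) →
           ΣB (λ α → Σ[ xs ] (f α)) ≈ Σ[ xs ] (λ x → ΣB (λ α → f α x))
  ΣB-sum xs f = sym (sum-+ xs (f true) (f false))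

  ΣB-sum³ : ∀ {A : Set} (xs : List A) (f : Bool → A → A → A → Carrier) →
    ΣB (λ α → Σ[ xs ] (λ x → Σ[ xs ] (λ y → Σ[ xs ] (λ z → f α x y z)))) ≈
    Σ[ xs ] (λ x → Σ[ xs ] (λ y → Σ[ xs ] (λ z → ΣB (λ α → f α x y z))))
  ΣB-sum³ xs f = trans (ΣB-sum xs (λ α x → Σ[ xs ] (λ y → Σ[ xs ] (λ z → f α x y z))))
    (sum-cong xs λ x → trans (ΣB-sum xs (λ α y → Σ[ xs ] (λ z → f α x y z)))
      (sum-cong xs λ y → ΣB-sum xs (λ α z → f α x y z)))

  Σ⊆ : List Edge → (List Edge → Carrier) → Carrier
  Σ⊆ E h = Σ[ subsets (length E) ] (λ s → h (chosen s E))

  Σ⊆-++ : ∀ A B (h : List Edge → Carrier) → Σ⊆ (A ++ B) h ≈ Σ⊆ A (λ X → Σ⊆ B (λ Y → h (X ++ Y)))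
  Σ⊆-++ []      B h = sym (+-identityʳ _)
  Σ⊆-++ (e ∷ A) B h = begin
    Σ[ map (true ∷_) S ++ map (false ∷_) S ] (λ s → h (chosen s (e ∷ A ++ B)))
      ≈⟨ sum-++ (map (true ∷_) S) _ _ ⟩
    Σ[ map (true ∷_) S ] (λ s → h (chosen s (e ∷ A ++ B))) + Σ[ map (false ∷_) S ] (λ s → h (chosen s (e ∷ A ++ B)))
      ≡⟨ ≡.cong₂ _+_ (sum-map S (true ∷_) _) (sum-map S (false ∷_) _) ⟩
    Σ⊆ (A ++ B) (λ X → h (e ∷ X)) + Σ⊆ (A ++ B) h
      ≈⟨ +-cong (Σ⊆-++ A B (λ X → h (e ∷ X))) (Σ⊆-++ A B h) ⟩
    Σ⊆ A (λ X → Σ⊆ B (λ Y → h (e ∷ X ++ Y))) + Σ⊆ A (λ X → Σ⊆ B (λ Y → h (X ++ Y)))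
      ≡⟨ ≡.sym (≡.cong₂ _+_ (sum-map SA (true ∷_) _) (sum-map SA (false ∷_) _)) ⟩
    Σ[ map (true ∷_) SA ] F + Σ[ map (false ∷_) SA ] F
      ≈⟨ sum-++ (map (true ∷_) SA) _ _ ⟨
    Σ[ map (true ∷_) SA ++ map (false ∷_) SA ] F ∎
    where
    S = subsets (length (A ++ B))
    SA = subsets (length A)
    F : List Bool → Carrier
    F s = Σ⊆ B (λ Y → h (chosen s (e ∷ A) ++ Y))

  Σ⊆-cong : ∀ {P : Edge → Set} {h h′ : List Edge → Carrier} E → All P E →
            (∀ X → All P X → h X ≈ h′ X) → Σ⊆ E h ≈ Σ⊆ E h′
  Σ⊆-cong E all-P h≈h′ = sum-cong (subsets (length E)) (λ s → h≈h′ (chosen s E) (chosen-All s E all-P))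
    where
    chosen-All : ∀ {P : Edge → Set} s E → All P E → All P (chosen s E)
    chosen-All (true  ∷ s) (e ∷ E) (pe ∷ pE) = pe ∷ chosen-All s E pE
    chosen-All (false ∷ s) (e ∷ E) (_ ∷ pE)  = chosen-All s E pE
    chosen-All []          _       _         = []
    chosen-All (true  ∷ _) []      _         = []
    chosen-All (false ∷ _) []      _         = []

  Σ⊆-map : ∀ (g : Edge → Edge) E (h : List Edge → Carrier) → Σ⊆ (map g E) h ≡ Σ⊆ E (λ X → h (map g X))
  Σ⊆-map g E h rewrite List.length-map g E =
    ≡.cong sumR (List.map-cong (λ s → ≡.cong h (chosen-map s E)) (subsets (length E)))
    where
    chosen-map : ∀ s E → chosen s (map g E) ≡ map g (chosen s E)
    chosen-map (true  ∷ s) (e ∷ E) = ≡.cong (g e ∷_) (chosen-map s E)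
    chosen-map (false ∷ s) (e ∷ E) = chosen-map s E
    chosen-map []          E       = ≡.refl
    chosen-map (true  ∷ _) []      = ≡.refl
    chosen-map (false ∷ _) []      = ≡.refl

  ΣB-*ˡ : ∀ x (f : Bool → Carrier) → ΣB (λ α → x * f α) ≈ x * ΣB f
  ΣB-*ˡ x f = sym (distribˡ x (f true) (f false))

  ΣB-*ʳ : ∀ x (f : Bool → Carrier) → ΣB (λ α → f α * x) ≈ ΣB f * x
  ΣB-*ʳ x f = sym (distribʳ x (f true) (f false))

  ΣB³-* : ∀ (f g h : Bool → Carrier) k →
    ΣB (λ α → ΣB (λ β → ΣB (λ γ → f α * (g β * (h γ * k))))) ≈ ΣB f * (ΣB g * (ΣB h * k))
  ΣB³-* f g h k = begin
    ΣB (λ α → ΣB (λ β → ΣB (λ γ → f α * (g β * (h γ * k)))))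
      ≈⟨ ΣB-cong (λ α → ΣB-cong (λ β → trans (ΣB-*ˡ (f α) (λ γ → g β * (h γ * k)))
           (*-congˡ (trans (ΣB-*ˡ (g β) (λ γ → h γ * k)) (*-congˡ (ΣB-*ʳ k h)))))) ⟩
    ΣB (λ α → ΣB (λ β → f α * (g β * (ΣB h * k))))
      ≈⟨ ΣB-cong (λ α → trans (ΣB-*ˡ (f α) (λ β → g β * (ΣB h * k))) (*-congˡ (ΣB-*ʳ _ g))) ⟩
    ΣB (λ α → f α * (ΣB g * (ΣB h * k)))
      ≈⟨ ΣB-*ʳ _ f ⟩
    ΣB f * (ΣB g * (ΣB h * k)) ∎

  sel : Bool → Carrier → Carrier
  sel b w = if b then w else 0#

  ind : Bool → Carrier
  ind b = sel b 1#

  sel-congʳ : ∀ b {w w′} → w ≈ w′ → sel b w ≈ sel b w′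
  sel-congʳ true  w≈w′ = w≈w′
  sel-congʳ false _    = refl

  sel≈ind* : ∀ b w → sel b w ≈ ind b * w
  sel≈ind* true  w = sym (*-identityˡ w)
  sel≈ind* false w = sym (zeroˡ w)

  sel-∧ : ∀ a b w → sel (a ∧ b) w ≈ ind a * sel b w
  sel-∧ true  b w = sym (*-identityˡ _)
  sel-∧ false b w = sym (zeroˡ _)

  ind-∧ : ∀ a b → ind (a ∧ b) ≈ ind a * ind b
  ind-∧ a b = sel-∧ a b 1#

  sel-∧⁴ : ∀ a b c d w → sel (a ∧ (b ∧ (c ∧ d))) w ≈ ind a * (ind b * (ind c * (ind d * w)))
  sel-∧⁴ a b c d w = trans (sel-∧ a _ w) (*-congˡ (trans (sel-∧ b _ w) (*-congˡ (trans (sel-∧ c _ w) (*-congˡ (sel≈ind* d w))))))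

  ΣB-ind-xnor : ∀ x y → ΣB (λ α → ind (x xnor α) * ind (y xnor α)) ≈ ind (x xnor y)
  ΣB-ind-xnor true  true  = trans (+-cong (*-identityˡ 1#) (zeroˡ 0#)) (+-identityʳ 1#)
  ΣB-ind-xnor true  false = trans (+-cong (zeroʳ 1#) (zeroˡ 1#)) (+-identityʳ 0#)
  ΣB-ind-xnor false true  = trans (+-cong (zeroˡ 1#) (zeroʳ 1#)) (+-identityʳ 0#)
  ΣB-ind-xnor false false = trans (+-cong (zeroˡ 0#) (*-identityˡ 1#)) (+-identityˡ 1#)

  -- α, β, γ are the parities at the three glue points; each ΣB collapses by ΣB-ind-xnor to the
  -- condition that the two corners glued there have equal parity.
  ΣB³-glue : ∀ (e₁L e₁T e₁R e₂L e₂T e₂R e₃L e₃T e₃R pL pT pR I₁ I₂ I₃ : Bool) (w₁ w₂ w₃ : Carrier) →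
    sel ((e₁L xnor pL) ∧ ((e₃T xnor pT) ∧ ((e₂R xnor pR) ∧
         ((((e₁T xnor e₃L) ∧ ((e₁R xnor e₂L) ∧ I₁)) ∧ ((e₂T xnor e₃R) ∧ I₂)) ∧ I₃)))) (w₁ * (w₂ * w₃))
    ≈ ΣB (λ α → ΣB (λ β → ΣB (λ γ →
        sel ((e₁L xnor pL) ∧ ((e₁T xnor β) ∧ ((e₁R xnor α) ∧ I₁))) w₁
      * sel ((e₂L xnor α) ∧ ((e₂T xnor γ) ∧ ((e₂R xnor pR) ∧ I₂))) w₂
      * sel ((e₃L xnor β) ∧ ((e₃T xnor pT) ∧ ((e₃R xnor γ) ∧ I₃))) w₃)))
  ΣB³-glue e₁L e₁T e₁R e₂L e₂T e₂R e₃L e₃T e₃R pL pT pR I₁ I₂ I₃ w₁ w₂ w₃ = begin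
    sel (c₁ ∧ (c₂ ∧ (c₃ ∧ K))) W
      ≈⟨ trans (sel-∧⁴ c₁ c₂ c₃ K W) (*-congˡ (*-congˡ (*-congˡ (*-congʳ ind-K)))) ⟩
    ind c₁ * (ind c₂ * (ind c₃ * ((((ind m₁₃ * (ind m₁₂ * ind I₁)) * (ind m₂₃ * ind I₂)) * ind I₃) * W)))
      ≈⟨ gather-lhs (ind c₁) (ind c₂) (ind c₃) (ind I₁) (ind I₂) (ind I₃) w₁ w₂ w₃ (ind m₁₂) (ind m₁₃) (ind m₂₃) ⟩
    ind m₁₂ * (ind m₁₃ * (ind m₂₃ * Rest))
      ≈⟨ *-cong (ΣB-ind-xnor e₁R e₂L) (*-cong (ΣB-ind-xnor e₁T e₃L) (*-congʳ (ΣB-ind-xnor e₂T e₃R))) ⟨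
    ΣB a * (ΣB b * (ΣB g * Rest))
      ≈⟨ ΣB³-* a b g Rest ⟨
    ΣB (λ α → ΣB (λ β → ΣB (λ γ → a α * (b β * (g γ * Rest)))))
      ≈⟨ ΣB-cong (λ α → ΣB-cong (λ β → ΣB-cong (λ γ → begin
           a α * (b β * (g γ * Rest))
             ≈⟨ gather-rhs (ind c₁) (ind c₂) (ind c₃) (ind I₁) (ind I₂) (ind I₃) w₁ w₂ w₃
                           (ind (e₁R xnor α)) (ind (e₂L xnor α)) (ind (e₁T xnor β)) (ind (e₃L xnor β))
                           (ind (e₂T xnor γ)) (ind (e₃R xnor γ)) ⟨
           (ind c₁ * (ind (e₁T xnor β) * (ind (e₁R xnor α) * (ind I₁ * w₁))))
             * (ind (e₂L xnor α) * (ind (e₂T xnor γ) * (ind c₃ * (ind I₂ * w₂))))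
             * (ind (e₃L xnor β) * (ind c₂ * (ind (e₃R xnor γ) * (ind I₃ * w₃))))
             ≈⟨ *-cong (*-cong (sel-∧⁴ c₁ _ _ I₁ w₁) (sel-∧⁴ _ _ c₃ I₂ w₂)) (sel-∧⁴ _ c₂ _ I₃ w₃) ⟨
           sel (c₁ ∧ ((e₁T xnor β) ∧ ((e₁R xnor α) ∧ I₁))) w₁
             * sel ((e₂L xnor α) ∧ ((e₂T xnor γ) ∧ (c₃ ∧ I₂))) w₂
             * sel ((e₃L xnor β) ∧ (c₂ ∧ ((e₃R xnor γ) ∧ I₃))) w₃ ∎))) ⟩
    ΣB (λ α → ΣB (λ β → ΣB (λ γ →
        sel (c₁ ∧ ((e₁T xnor β) ∧ ((e₁R xnor α) ∧ I₁))) w₁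
      * sel ((e₂L xnor α) ∧ ((e₂T xnor γ) ∧ (c₃ ∧ I₂))) w₂
      * sel ((e₃L xnor β) ∧ (c₂ ∧ ((e₃R xnor γ) ∧ I₃))) w₃))) ∎
    where
    c₁ = e₁L xnor pL
    c₂ = e₃T xnor pT
    c₃ = e₂R xnor pR
    m₁₃ = e₁T xnor e₃L
    m₁₂ = e₁R xnor e₂L
    m₂₃ = e₂T xnor e₃R
    K = (((m₁₃ ∧ (m₁₂ ∧ I₁)) ∧ (m₂₃ ∧ I₂)) ∧ I₃)
    W = w₁ * (w₂ * w₃)
    ind-K : ind K ≈ ((ind m₁₃ * (ind m₁₂ * ind I₁)) * (ind m₂₃ * ind I₂)) * ind I₃
    ind-K = trans (ind-∧ _ I₃) (*-congʳ (trans (ind-∧ _ _) (*-cong (trans (ind-∧ m₁₃ _) (*-congˡ (ind-∧ m₁₂ I₁))) (ind-∧ m₂₃ I₂))))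
    Rest = ind c₁ * (ind c₂ * (ind c₃ * (ind I₁ * (ind I₂ * (ind I₃ * (w₁ * (w₂ * w₃)))))))
    a b g : Bool → Carrier
    a α = ind (e₁R xnor α) * ind (e₂L xnor α)
    b β = ind (e₁T xnor β) * ind (e₃L xnor β)
    g γ = ind (e₂T xnor γ) * ind (e₃R xnor γ)

    open import Algebra.Solver.CommutativeMonoid *-commutativeMonoid using (solve; _⊜_; _⊕_)

    gather-lhs : ∀ c₁ c₂ c₃ i₁ i₂ i₃ w₁ w₂ w₃ m₁₂ m₁₃ m₂₃ →
      c₁ * (c₂ * (c₃ * ((((m₁₃ * (m₁₂ * i₁)) * (m₂₃ * i₂)) * i₃) * (w₁ * (w₂ * w₃)))))
      ≈ m₁₂ * (m₁₃ * (m₂₃ * (c₁ * (c₂ * (c₃ * (i₁ * (i₂ * (i₃ * (w₁ * (w₂ * w₃))))))))))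
    gather-lhs = solve 12 (λ c₁ c₂ c₃ i₁ i₂ i₃ w₁ w₂ w₃ m₁₂ m₁₃ m₂₃ →
      c₁ ⊕ (c₂ ⊕ (c₃ ⊕ ((((m₁₃ ⊕ (m₁₂ ⊕ i₁)) ⊕ (m₂₃ ⊕ i₂)) ⊕ i₃) ⊕ (w₁ ⊕ (w₂ ⊕ w₃)))))
      ⊜ m₁₂ ⊕ (m₁₃ ⊕ (m₂₃ ⊕ (c₁ ⊕ (c₂ ⊕ (c₃ ⊕ (i₁ ⊕ (i₂ ⊕ (i₃ ⊕ (w₁ ⊕ (w₂ ⊕ w₃))))))))))) refl

    gather-rhs : ∀ c₁ c₂ c₃ i₁ i₂ i₃ w₁ w₂ w₃ a₁ a₂ b₁ b₃ g₂ g₃ →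
      ((c₁ * (b₁ * (a₁ * (i₁ * w₁)))) * (a₂ * (g₂ * (c₃ * (i₂ * w₂))))) * (b₃ * (c₂ * (g₃ * (i₃ * w₃))))
      ≈ (a₁ * a₂) * ((b₁ * b₃) * ((g₂ * g₃) * (c₁ * (c₂ * (c₃ * (i₁ * (i₂ * (i₃ * (w₁ * (w₂ * w₃))))))))))
    gather-rhs = solve 15 (λ c₁ c₂ c₃ i₁ i₂ i₃ w₁ w₂ w₃ a₁ a₂ b₁ b₃ g₂ g₃ →
      ((c₁ ⊕ (b₁ ⊕ (a₁ ⊕ (i₁ ⊕ w₁)))) ⊕ (a₂ ⊕ (g₂ ⊕ (c₃ ⊕ (i₂ ⊕ w₂))))) ⊕ (b₃ ⊕ (c₂ ⊕ (g₃ ⊕ (i₃ ⊕ w₃))))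
      ⊜ (a₁ ⊕ a₂) ⊕ ((b₁ ⊕ b₃) ⊕ ((g₂ ⊕ g₃) ⊕ (c₁ ⊕ (c₂ ⊕ (c₃ ⊕ (i₁ ⊕ (i₂ ⊕ (i₃ ⊕ (w₁ ⊕ (w₂ ⊕ w₃))))))))))) refl

module TransferMatrix {c ℓ : Level} (R : CommutativeRing c ℓ) (a b c′ : CommutativeRing.Carrier R) where
  open CommutativeRing R
  open Gen R using (weight; ΓclG)
  open Sums R
  open import Relation.Binary.Reasoning.Setoid setoid

  w : List Edge → Carrier
  w = weight a b c′

  contribution : LGraph → Bool → Bool → Bool → List Edge → Carrier
  contribution G pL pT pR X = sel (hasParities G pL pT pR X) (w X)

  F : LGraph → Bool → Bool → Bool → Carrier
  F G pL pT pR = Σ⊆ (edges G) (contribution G pL pT pR)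

  weight-map : ∀ f X → w (map (mapEdge f) X) ≡ w X
  weight-map f []                 = ≡.refl
  weight-map f ((_ , _ , la) ∷ X) = ≡.cong (a *_) (weight-map f X)
  weight-map f ((_ , _ , lb) ∷ X) = ≡.cong (b *_) (weight-map f X)
  weight-map f ((_ , _ , lc) ∷ X) = ≡.cong (c′ *_) (weight-map f X)

  weight-++ : ∀ X Y → w (X ++ Y) ≈ w X * w Y
  weight-++ []                 Y = sym (*-identityˡ _)
  weight-++ ((_ , _ , la) ∷ X) Y = trans (*-congˡ (weight-++ X Y)) (sym (*-assoc _ _ _))
  weight-++ ((_ , _ , lb) ∷ X) Y = trans (*-congˡ (weight-++ X Y)) (sym (*-assoc _ _ _))
  weight-++ ((_ , _ , lc) ∷ X) Y = trans (*-congˡ (weight-++ X Y)) (sym (*-assoc _ _ _))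

  Γcl≈F-even : ∀ G → WellFormed G → ΓclG G a b c′ ≈ F G false false false
  Γcl≈F-even G wf = sum-cong (subsets (length (edges G))) λ s →
    reflexive (≡.cong (λ b → sel b (w (chosen s (edges G)))) (Corners.isClosed≡hasParities-even G wf (chosen s (edges G))))

  module _ (G : LGraph) (wf : WellFormed G) where
    open WellFormed wf
    open Gluing G wf
    private
      E = edges G
      N = nv G

    Σ⊆-step : ∀ (h : List Edge → Carrier) →
      Σ⊆ (edges (step G)) h ≈ Σ⊆ E (λ X₁ → Σ⊆ E (λ X₂ → Σ⊆ E (λ X₃ → h (glued X₁ X₂ X₃))))
    Σ⊆-step h = begin
      Σ⊆ (map g (A ++ (B ++ C))) h
        ≡⟨ Σ⊆-map g (A ++ (B ++ C)) h ⟩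
      Σ⊆ (A ++ (B ++ C)) (λ X → h (map g X))
        ≈⟨ Σ⊆-++ A (B ++ C) (λ X → h (map g X)) ⟩
      Σ⊆ A (λ X → Σ⊆ (B ++ C) (λ Y → h (map g (X ++ Y))))
        ≈⟨ sum-cong (subsets (length A)) (λ s → Σ⊆-++ B C (λ Y → h (map g (chosen s A ++ Y)))) ⟩
      Σ⊆ A (λ X → Σ⊆ B (λ Y → Σ⊆ C (λ Z → h (map g (X ++ (Y ++ Z))))))
        ≡⟨ Σ⊆-map (mapEdge (0 ℕ.+_)) E (λ X → Σ⊆ B (λ Y → Σ⊆ C (λ Z → h (map g (X ++ (Y ++ Z)))))) ⟩
      Σ⊆ E (λ X₁ → Σ⊆ B (λ Y → Σ⊆ C (λ Z → h (map g (shift 0 X₁ ++ (Y ++ Z))))))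
        ≈⟨ sum-cong (subsets (length E)) (λ s₁ →
             trans (reflexive (Σ⊆-map (mapEdge (N ℕ.+_)) E
                                 (λ Y → Σ⊆ C (λ Z → h (map g (shift 0 (chosen s₁ E) ++ (Y ++ Z)))))))
             (sum-cong (subsets (length E)) (λ s₂ →
               reflexive (Σ⊆-map (mapEdge ((N ℕ.+ N) ℕ.+_)) E
                                 (λ Z → h (map g (shift 0 (chosen s₁ E) ++ (shift N (chosen s₂ E) ++ Z)))))))) ⟩
      Σ⊆ E (λ X₁ → Σ⊆ E (λ X₂ → Σ⊆ E (λ X₃ → h (glued X₁ X₂ X₃)))) ∎
      where
      g = mapEdge glue
      A = shift 0 E
      B = shift N E
      C = shift (N ℕ.+ N) E

    weight-glued : ∀ X₁ X₂ X₃ → w (glued X₁ X₂ X₃) ≈ w X₁ * (w X₂ * w X₃)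
    weight-glued X₁ X₂ X₃ = begin
      w (map (mapEdge glue) (shift 0 X₁ ++ (shift N X₂ ++ shift (N ℕ.+ N) X₃)))
        ≡⟨ weight-map glue (shift 0 X₁ ++ (shift N X₂ ++ shift (N ℕ.+ N) X₃)) ⟩
      w (shift 0 X₁ ++ (shift N X₂ ++ shift (N ℕ.+ N) X₃))
        ≈⟨ trans (weight-++ (shift 0 X₁) _) (*-congˡ (weight-++ (shift N X₂) _)) ⟩
      w (shift 0 X₁) * (w (shift N X₂) * w (shift (N ℕ.+ N) X₃))
        ≡⟨ ≡.cong₂ _*_ (weight-map _ X₁) (≡.cong₂ _*_ (weight-map _ X₂) (weight-map _ X₃)) ⟩
      w X₁ * (w X₂ * w X₃) ∎

    contribution-glued : ∀ pL pT pR {X₁ X₂ X₃} →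
      All (EdgeBelow N) X₁ → All (EdgeBelow N) X₂ → All (EdgeBelow N) X₃ →
      contribution (step G) pL pT pR (glued X₁ X₂ X₃) ≈
      ΣB (λ α → ΣB (λ β → ΣB (λ γ →
        contribution G pL β α X₁ * contribution G α γ pR X₂ * contribution G β pT γ X₃)))
    contribution-glued pL pT pR {X₁} {X₂} {X₃} X₁<N X₂<N X₃<N = begin
      sel (hasParities (step G) pL pT pR (glued X₁ X₂ X₃)) (w (glued X₁ X₂ X₃))
        ≡⟨ ≡.cong (λ b → sel b (w (glued X₁ X₂ X₃))) (hasParities-glued X₁<N X₂<N X₃<N pL pT pR) ⟩
      sel _ (w (glued X₁ X₂ X₃))
        ≈⟨ sel-congʳ _ (weight-glued X₁ X₂ X₃) ⟩
      sel _ (w X₁ * (w X₂ * w X₃))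
        ≈⟨ ΣB³-glue (oddAt X₁ (cL G)) (oddAt X₁ (cT G)) (oddAt X₁ (cR G)) (oddAt X₂ (cL G)) (oddAt X₂ (cT G))
                    (oddAt X₂ (cR G)) (oddAt X₃ (cL G)) (oddAt X₃ (cT G)) (oddAt X₃ (cR G)) pL pT pR
                    (innerEven G X₁) (innerEven G X₂) (innerEven G X₃) (w X₁) (w X₂) (w X₃) ⟩
      ΣB (λ α → ΣB (λ β → ΣB (λ γ →
        contribution G pL β α X₁ * contribution G α γ pR X₂ * contribution G β pT γ X₃))) ∎

    F-step : ∀ pL pT pR →
      F (step G) pL pT pR ≈ ΣB (λ α → ΣB (λ β → ΣB (λ γ → F G pL β α * F G α γ pR * F G β pT γ)))
    F-step pL pT pR = begin
      F (step G) pL pT pR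
        ≈⟨ Σ⊆-step (contribution (step G) pL pT pR) ⟩
      Σ⊆³ (λ X₁ X₂ X₃ → contribution (step G) pL pT pR (glued X₁ X₂ X₃))
        ≈⟨ Σ⊆-cong E edges<n (λ X₁ X₁<N → Σ⊆-cong E edges<n (λ X₂ X₂<N → Σ⊆-cong E edges<n (λ X₃ X₃<N →
             contribution-glued pL pT pR X₁<N X₂<N X₃<N))) ⟩
      Σ⊆³ (λ X₁ X₂ X₃ → ΣB (λ α → ΣB (λ β → ΣB (λ γ → φ pL β α X₁ * φ α γ pR X₂ * φ β pT γ X₃))))
        ≈⟨ ΣB-sum³ S (λ α s₁ s₂ s₃ → ΣB (λ β → ΣB (λ γ → summand α β γ s₁ s₂ s₃))) ⟨
      ΣB (λ α → Σ⊆³′ (λ s₁ s₂ s₃ → ΣB (λ β → ΣB (λ γ → summand α β γ s₁ s₂ s₃))))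
        ≈⟨ ΣB-cong (λ α → ΣB-sum³ S (λ β s₁ s₂ s₃ → ΣB (λ γ → summand α β γ s₁ s₂ s₃))) ⟨
      ΣB (λ α → ΣB (λ β → Σ⊆³′ (λ s₁ s₂ s₃ → ΣB (λ γ → summand α β γ s₁ s₂ s₃))))
        ≈⟨ ΣB-cong (λ α → ΣB-cong (λ β → ΣB-sum³ S (λ γ s₁ s₂ s₃ → summand α β γ s₁ s₂ s₃))) ⟨
      ΣB (λ α → ΣB (λ β → ΣB (λ γ → Σ⊆³′ (summand α β γ))))
        ≈⟨ ΣB-cong (λ α → ΣB-cong (λ β → ΣB-cong (λ γ → sum³-* S (λ s → φ pL β α (chosen s E))
             (λ s → φ α γ pR (chosen s E)) (λ s → φ β pT γ (chosen s E))))) ⟨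
      ΣB (λ α → ΣB (λ β → ΣB (λ γ → F G pL β α * F G α γ pR * F G β pT γ))) ∎
      where
      S = subsets (length E)
      φ = contribution G
      Σ⊆³ : (List Edge → List Edge → List Edge → Carrier) → Carrier
      Σ⊆³ f = Σ⊆ E (λ X₁ → Σ⊆ E (λ X₂ → Σ⊆ E (λ X₃ → f X₁ X₂ X₃)))
      Σ⊆³′ : (List Bool → List Bool → List Bool → Carrier) → Carrier
      Σ⊆³′ f = Σ[ S ] (λ s₁ → Σ[ S ] (λ s₂ → Σ[ S ] (λ s₃ → f s₁ s₂ s₃)))
      summand : Bool → Bool → Bool → List Bool → List Bool → List Bool → Carrier
      summand α β γ s₁ s₂ s₃ = φ pL β α (chosen s₁ E) * φ α γ pR (chosen s₂ E) * φ β pT γ (chosen s₃ E)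

-- F (Ω k) indexed by the corner parities: no odd corner, two odd corners, or (impossible by the
-- handshake lemma) one or three.
parityTable : ∀ {a} {A : Set a} → A → A → A → Bool → Bool → Bool → A
parityTable z x y false false false = x
parityTable z x y true  true  false = y
parityTable z x y true  false true  = y
parityTable z x y false true  true  = y
parityTable z x y _     _     _     = z

module BaseCase {c ℓ : Level} (R : CommutativeRing c ℓ) (a b c′ : CommutativeRing.Carrier R) where
  open import Data.Integer.Base using (+_)
  open CommutativeRing R
  open Gen R
  open TransferMatrix R a b c′
  open IntegerCoefficientSolver R

  P : Carrier
  P = a ^ 2 * b ^ 2 * c′ ^ 2 - a ^ 2 * b ^ 2 * c′ + a ^ 2 * b ^ 2
      + 4 · (a * b * c′) + c′ ^ 2 - c′ + 1# + a ^ 2 * c′ + b ^ 2 * c′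

  X₀ Y₀ : Carrier
  X₀ = ((1# + c′) * (1# + a * b)) * (P - Qf a b c′)
  Y₀ = Qf a b c′ * ((1# + c′) * (1# + a * b))

  private
    aₚ bₚ cₚ : Polynomial 3
    aₚ = var (# 0)
    bₚ = var (# 1)
    cₚ = var (# 2)

    weightₚ : List Edge → Polynomial 3
    weightₚ []                  = con (+ 1)
    weightₚ ((_ , _ , la) ∷ X) = aₚ :* weightₚ X
    weightₚ ((_ , _ , lb) ∷ X) = bₚ :* weightₚ X
    weightₚ ((_ , _ , lc) ∷ X) = cₚ :* weightₚ X

    -- F Ω₂ as a formal polynomial: it evaluates to F Ω₂ by computation alone, so each case of
    -- F-Ω₂ is closed by normalising both sides.
    Fₚ : Bool → Bool → Bool → Polynomial 3
    Fₚ pL pT pR = foldr _:+_ (con (+ 0))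
      (map (λ s → let X = chosen s (edges Ω₂) in if hasParities Ω₂ pL pT pR X then weightₚ X else con (+ 0))
           (subsets (length (edges Ω₂))))

    Pₚ Qₚ Kₚ : Polynomial 3
    Pₚ = aₚ :^ 2 :* bₚ :^ 2 :* cₚ :^ 2 :- aₚ :^ 2 :* bₚ :^ 2 :* cₚ :+ aₚ :^ 2 :* bₚ :^ 2
         :+ 4 :× (aₚ :* bₚ :* cₚ) :+ cₚ :^ 2 :- cₚ :+ con (+ 1) :+ aₚ :^ 2 :* cₚ :+ bₚ :^ 2 :* cₚ
    Qₚ = (aₚ :+ bₚ :* cₚ) :* (bₚ :+ aₚ :* cₚ)
    Kₚ = (con (+ 1) :+ cₚ) :* (con (+ 1) :+ aₚ :* bₚ)

    valueₚ : Bool → Bool → Bool → Polynomial 3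
    valueₚ = parityTable (con (+ 0)) (Kₚ :* (Pₚ :- Qₚ)) (Qₚ :* Kₚ)

  F-Ω₂ : ∀ pL pT pR → F Ω₂ pL pT pR ≈ parityTable 0# X₀ Y₀ pL pT pR
  F-Ω₂ false false false = prove (a ∷ b ∷ c′ ∷ []) (Fₚ false false false) (valueₚ false false false) refl
  F-Ω₂ true  true  false = prove (a ∷ b ∷ c′ ∷ []) (Fₚ true  true  false) (valueₚ true  true  false) refl
  F-Ω₂ true  false true  = prove (a ∷ b ∷ c′ ∷ []) (Fₚ true  false true ) (valueₚ true  false true ) refl
  F-Ω₂ false true  true  = prove (a ∷ b ∷ c′ ∷ []) (Fₚ false true  true ) (valueₚ false true  true ) refl
  F-Ω₂ true  false false = prove (a ∷ b ∷ c′ ∷ []) (Fₚ true  false false) (valueₚ true  false false) refl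
  F-Ω₂ false true  false = prove (a ∷ b ∷ c′ ∷ []) (Fₚ false true  false) (valueₚ false true  false) refl
  F-Ω₂ false false true  = prove (a ∷ b ∷ c′ ∷ []) (Fₚ false false true ) (valueₚ false false true ) refl
  F-Ω₂ true  true  true  = prove (a ∷ b ∷ c′ ∷ []) (Fₚ true  true  true ) (valueₚ true  true  true ) refl

module RingFacts {c ℓ : Level} (R : CommutativeRing c ℓ) where
  open import Data.Integer.Base using (+_)
  open CommutativeRing R
  open Gen R
  open Sums R using (ΣB)
  open IntegerCoefficientSolver R using (Polynomial; var; prove; solve; _:=_; _:+_; _:*_; _:-_; _:^_; _:×_; con)
  open import Algebra.Properties.Semiring.Exp semiring using (^-assocʳ; ^-congˡ; ^-congʳ)
  open import Algebra.Properties.CommutativeSemiring.Exp commutativeSemiring using (^-distrib-*)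
  open import Relation.Binary.Reasoning.Setoid setoid

  private
    ΣBₚ : (Bool → Polynomial 2) → Polynomial 2
    ΣBₚ f = f true :+ f false

    xₚ yₚ : Polynomial 2
    xₚ = var (# 0)
    yₚ = var (# 1)

    stepₚ nextₚ : Bool → Bool → Bool → Polynomial 2
    stepₚ pL pT pR = ΣBₚ (λ α → ΣBₚ (λ β → ΣBₚ (λ γ → t pL β α :* t α γ pR :* t β pT γ)))
      where t = parityTable (con (+ 0)) xₚ yₚ
    nextₚ = parityTable (con (+ 0)) (xₚ :^ 3 :+ yₚ :^ 3) (xₚ :* yₚ :^ 2 :+ yₚ :^ 3)

  parityTable-step : ∀ x y pL pT pR →
    ΣB (λ α → ΣB (λ β → ΣB (λ γ → parityTable 0# x y pL β α * parityTable 0# x y α γ pR * parityTable 0# x y β pT γ)))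
    ≈ parityTable 0# (x ^ 3 + y ^ 3) (x * y ^ 2 + y ^ 3) pL pT pR
  parityTable-step x y false false false = prove (x ∷ y ∷ []) (stepₚ false false false) (nextₚ false false false) refl
  parityTable-step x y true  true  false = prove (x ∷ y ∷ []) (stepₚ true  true  false) (nextₚ true  true  false) refl
  parityTable-step x y true  false true  = prove (x ∷ y ∷ []) (stepₚ true  false true ) (nextₚ true  false true ) refl
  parityTable-step x y false true  true  = prove (x ∷ y ∷ []) (stepₚ false true  true ) (nextₚ false true  true ) refl
  parityTable-step x y true  false false = prove (x ∷ y ∷ []) (stepₚ true  false false) (nextₚ true  false false) refl
  parityTable-step x y false true  false = prove (x ∷ y ∷ []) (stepₚ false true  false) (nextₚ false true  false) refl
  parityTable-step x y false false true  = prove (x ∷ y ∷ []) (stepₚ false false true ) (nextₚ false false true ) refl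
  parityTable-step x y true  true  true  = prove (x ∷ y ∷ []) (stepₚ true  true  true ) (nextₚ true  true  true ) refl

  1^n≈1 : ∀ n → 1# ^ n ≈ 1#
  1^n≈1 zero    = refl
  1^n≈1 (suc n) = trans (*-identityˡ _) (1^n≈1 n)

  ^-cubed : ∀ x n → (x ^ n) ^ 3 ≈ x ^ (3 ℕ.* n)
  ^-cubed x n = trans (^-assocʳ x n 3) (^-congʳ x (ℕ.*-comm n 3))

  *³-^ : ∀ x y z n → (x * y * z) ^ n ≈ x ^ n * y ^ n * z ^ n
  *³-^ x y z n = trans (^-distrib-* (x * y) z n) (*-congʳ (^-distrib-* x y n))

  -- The renormalisation (x, y) ↦ (x³ + y³, x y² + y³) preserves x = y (p − 1) with p ↦ p² − 3p + 4.
  cube-step-y : ∀ x y p → x ≈ y * (p - 1#) → x * y ^ 2 + y ^ 3 ≈ y ^ 3 * p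
  cube-step-y x y p x≈ = begin
    x * y ^ 2 + y ^ 3             ≈⟨ +-congʳ (*-congʳ x≈) ⟩
    y * (p - 1#) * y ^ 2 + y ^ 3  ≈⟨ solve 2 (λ y p → y :* (p :- con (+ 1)) :* y :^ 2 :+ y :^ 3 := y :^ 3 :* p) refl y p ⟩
    y ^ 3 * p                     ∎

  cube-step-x : ∀ x y p → x ≈ y * (p - 1#) →
    x ^ 3 + y ^ 3 ≈ (x * y ^ 2 + y ^ 3) * ((p * p - 3 · p + 4 · 1#) - 1#)
  cube-step-x x y p x≈ = begin
    x ^ 3 + y ^ 3
      ≈⟨ +-congʳ (^-congˡ 3 x≈) ⟩
    (y * (p - 1#)) ^ 3 + y ^ 3
      ≈⟨ solve 2 (λ y p → (y :* (p :- con (+ 1))) :^ 3 :+ y :^ 3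
                          := y :^ 3 :* p :* ((p :* p :- 3 :× p :+ 4 :× con (+ 1)) :- con (+ 1))) refl y p ⟩
    y ^ 3 * p * ((p * p - 3 · p + 4 · 1#) - 1#)
      ≈⟨ *-congʳ (cube-step-y x y p x≈) ⟨
    (x * y ^ 2 + y ^ 3) * ((p * p - 3 · p + 4 · 1#) - 1#) ∎

  prodR-∷ʳ : ∀ {A : Set} (g : A → Carrier) xs x → prodR (map g (xs ∷ʳ x)) ≈ prodR (map g xs) * g x
  prodR-∷ʳ g []       x = trans (*-identityʳ _) (sym (*-identityˡ _))
  prodR-∷ʳ g (y ∷ xs) x = trans (*-congˡ (prodR-∷ʳ g xs x)) (sym (*-assoc _ _ _))

  prodR-^ : ∀ {A : Set} (g : A → Carrier) xs n → prodR (map (λ x → g x ^ n) xs) ≈ prodR (map g xs) ^ n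
  prodR-^ g []       n = sym (1^n≈1 n)
  prodR-^ g (x ∷ xs) n = trans (*-congˡ (prodR-^ g xs n)) (sym (^-distrib-* (g x) _ n))

  prodR-applyUpTo-cong : ∀ (g h : ℕ → Carrier) f n → (∀ i → i ℕ.< n → g (f i) ≈ h (f i)) →
    prodR (map g (applyUpTo f n)) ≈ prodR (map h (applyUpTo f n))
  prodR-applyUpTo-cong g h f zero    g≈h = refl
  prodR-applyUpTo-cong g h f (suc n) g≈h =
    *-cong (g≈h 0 (s≤s z≤n)) (prodR-applyUpTo-cong g h (f ∘ suc) n (λ i i<n → g≈h (suc i) (s≤s i<n)))

module PolygonCounts {c ℓ : Level} (R : CommutativeRing c ℓ) (a b c′ : CommutativeRing.Carrier R) where
  open import Data.Integer.Base using (+_)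
  open CommutativeRing R
  open Gen R
  open Sums R
  open TransferMatrix R a b c′
  open BaseCase R a b c′ using (P; X₀; Y₀; F-Ω₂)
  open IntegerCoefficientSolver R using (solve; _:=_; _:+_; _:*_; _:-_; _:^_; con)
  open RingFacts R
  open import Relation.Binary.Reasoning.Setoid setoid

  X Y : ℕ → Carrier
  X zero    = X₀
  X (suc k) = X k ^ 3 + Y k ^ 3
  Y zero    = Y₀
  Y (suc k) = X k * Y k ^ 2 + Y k ^ 3

  F-Ω : ∀ k pL pT pR → F (Ω k) pL pT pR ≈ parityTable 0# (X k) (Y k) pL pT pR
  F-Ω zero    pL pT pR = F-Ω₂ pL pT pR
  F-Ω (suc k) pL pT pR = begin
    F (step (Ω k)) pL pT pR
      ≈⟨ F-step (Ω k) (wellFormed-Ω k) pL pT pR ⟩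
    ΣB (λ α → ΣB (λ β → ΣB (λ γ → F (Ω k) pL β α * F (Ω k) α γ pR * F (Ω k) β pT γ)))
      ≈⟨ ΣB-cong (λ α → ΣB-cong (λ β → ΣB-cong (λ γ →
           *-cong (*-cong (F-Ω k pL β α) (F-Ω k α γ pR)) (F-Ω k β pT γ)))) ⟩
    ΣB (λ α → ΣB (λ β → ΣB (λ γ → t pL β α * t α γ pR * t β pT γ)))
      ≈⟨ parityTable-step (X k) (Y k) pL pT pR ⟩
    parityTable 0# (X (suc k)) (Y (suc k)) pL pT pR ∎
    where t = parityTable 0# (X k) (Y k)

  module ClosedForm (q qinv : Carrier) (q⁴≈Q : q ^ 4 ≈ Qf a b c′) (q*qinv≈1 : q * qinv ≈ 1#) where
    open import Algebra.Properties.CommutativeSemiring.Exp commutativeSemiring using (^-distrib-*)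
    open import Algebra.Properties.Semiring.Exp semiring using (^-congˡ; ^-congʳ)

    private
      ψₖ : ℕ → Carrier
      ψₖ = ψ a b c′ qinv

      Q K : Carrier
      Q = Qf a b c′
      K = (1# + c′) * (1# + a * b)

      [q*qinv]^≈1 : ∀ n → q ^ n * qinv ^ n ≈ 1#
      [q*qinv]^≈1 n = trans (sym (^-distrib-* q qinv n)) (trans (^-congˡ n q*qinv≈1) (1^n≈1 n))

    X≈Y*[ψ-1] : ∀ k → X k ≈ Y k * (ψₖ (3 ℕ.+ k) - 1#)
    X≈Y*[ψ-1] zero = sym (begin
      Q * K * (P * qinv ^ 4 - 1#)
        ≈⟨ solve 4 (λ Q K P qi → Q :* K :* (P :* qi :^ 4 :- con (+ 1)) := K :* (P :* (Q :* qi :^ 4) :- Q)) refl Q K P qinv ⟩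
      K * (P * (Q * qinv ^ 4) - Q)
        ≈⟨ *-congˡ (+-congʳ (*-congˡ (trans (*-congʳ (sym q⁴≈Q)) ([q*qinv]^≈1 4)))) ⟩
      K * (P * 1# - Q)
        ≈⟨ *-congˡ (+-congʳ (*-identityʳ P)) ⟩
      K * (P - Q) ∎)
    X≈Y*[ψ-1] (suc k) = cube-step-x (X k) (Y k) (ψₖ (3 ℕ.+ k)) (X≈Y*[ψ-1] k)

    Y-suc : ∀ k → Y (suc k) ≈ Y k ^ 3 * ψₖ (3 ℕ.+ k)
    Y-suc k = cube-step-y (X k) (Y k) (ψₖ (3 ℕ.+ k)) (X≈Y*[ψ-1] k)

    prodψ-step : ∀ k → prodψ a b c′ qinv (3 ℕ.+ k) ≈ prodψ a b c′ qinv (2 ℕ.+ k) ^ 3 * ψₖ (3 ℕ.+ k)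
    prodψ-step k = begin
      prodR (map g′ (applyUpTo (2 ℕ.+_) (2 ℕ.+ k)))
        ≡⟨ ≡.cong (λ js → prodR (map g′ js)) (≡.sym (List.applyUpTo-∷ʳ (2 ℕ.+_) (suc k))) ⟩
      prodR (map g′ (applyUpTo (2 ℕ.+_) (suc k) ∷ʳ (3 ℕ.+ k)))
        ≈⟨ prodR-∷ʳ g′ (applyUpTo (2 ℕ.+_) (suc k)) (3 ℕ.+ k) ⟩
      prodR (map g′ (applyUpTo (2 ℕ.+_) (suc k))) * g′ (3 ℕ.+ k)
        ≈⟨ *-cong (prodR-applyUpTo-cong g′ (λ j → g j ^ 3) (2 ℕ.+_) (suc k) g′≈g³)
                  (trans (^-congʳ (ψₖ (3 ℕ.+ k)) (≡.cong (3 ℕ.^_) (ℕ.n∸n≡0 k))) (*-identityʳ _)) ⟩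
      prodR (map (λ j → g j ^ 3) (applyUpTo (2 ℕ.+_) (suc k))) * ψₖ (3 ℕ.+ k)
        ≈⟨ *-congʳ (prodR-^ g (applyUpTo (2 ℕ.+_) (suc k)) 3) ⟩
      prodψ a b c′ qinv (2 ℕ.+ k) ^ 3 * ψₖ (3 ℕ.+ k) ∎
      where
      g′ g : ℕ → Carrier
      g′ j = ψₖ j ^ (3 ℕ.^ (3 ℕ.+ k ∸ j))
      g  j = ψₖ j ^ (3 ℕ.^ (2 ℕ.+ k ∸ j))
      g′≈g³ : ∀ i → i ℕ.< suc k → g′ (2 ℕ.+ i) ≈ g (2 ℕ.+ i) ^ 3
      g′≈g³ i (s≤s i≤k) = begin
        ψₖ (2 ℕ.+ i) ^ (3 ℕ.^ (suc k ∸ i))       ≡⟨ ≡.cong (λ e → ψₖ (2 ℕ.+ i) ^ (3 ℕ.^ e)) (ℕ.+-∸-assoc 1 i≤k) ⟩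
        ψₖ (2 ℕ.+ i) ^ (3 ℕ.* 3 ℕ.^ (k ∸ i))     ≈⟨ ^-cubed (ψₖ (2 ℕ.+ i)) (3 ℕ.^ (k ∸ i)) ⟨
        (ψₖ (2 ℕ.+ i) ^ (3 ℕ.^ (k ∸ i))) ^ 3     ∎

    Y-closed-form : ∀ k → Y k ≈ q ^ (7 ℕ.* 3 ℕ.^ k) * ψₖ 1 ^ (3 ℕ.^ k) * prodψ a b c′ qinv (2 ℕ.+ k)
    Y-closed-form zero = sym (begin
      q ^ 7 * ((1# + c′) * qinv) ^ 1 * (((1# + a * b) * qinv ^ 2) ^ 1 * 1#)
        ≈⟨ solve 5 (λ q qi a b c → q :^ 7 :* ((con (+ 1) :+ c) :* qi) :^ 1 :* (((con (+ 1) :+ a :* b) :* qi :^ 2) :^ 1 :* con (+ 1))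
                        := q :^ 4 :* (q :^ 3 :* qi :^ 3) :* ((con (+ 1) :+ c) :* (con (+ 1) :+ a :* b))) refl q qinv a b c′ ⟩
      q ^ 4 * (q ^ 3 * qinv ^ 3) * K
        ≈⟨ *-congʳ (*-cong q⁴≈Q ([q*qinv]^≈1 3)) ⟩
      Q * 1# * K
        ≈⟨ *-congʳ (*-identityʳ Q) ⟩
      Q * K ∎)
    Y-closed-form (suc k) = begin
      Y (suc k)                                        ≈⟨ Y-suc k ⟩
      Y k ^ 3 * ψₖ (3 ℕ.+ k)                           ≈⟨ *-congʳ (^-congˡ 3 (Y-closed-form k)) ⟩
      (A * B * C) ^ 3 * ψₖ (3 ℕ.+ k)                   ≈⟨ *-congʳ (*³-^ A B C 3) ⟩
      A ^ 3 * B ^ 3 * C ^ 3 * ψₖ (3 ℕ.+ k)             ≈⟨ *-assoc _ _ _ ⟩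
      A ^ 3 * B ^ 3 * (C ^ 3 * ψₖ (3 ℕ.+ k))
        ≈⟨ *-cong (*-cong (^-cubed q (7 ℕ.* 3 ℕ.^ k)) (^-cubed (ψₖ 1) (3 ℕ.^ k))) (sym (prodψ-step k)) ⟩
      q ^ (3 ℕ.* (7 ℕ.* 3 ℕ.^ k)) * ψₖ 1 ^ (3 ℕ.^ suc k) * prodψ a b c′ qinv (3 ℕ.+ k)
        -- 3 * 7 and 7 * 3 both compute to 21
        ≡⟨ ≡.cong (λ e → q ^ e * ψₖ 1 ^ (3 ℕ.^ suc k) * prodψ a b c′ qinv (3 ℕ.+ k))
                  (≡.trans (≡.sym (ℕ.*-assoc 3 7 (3 ℕ.^ k))) (ℕ.*-assoc 7 3 (3 ℕ.^ k))) ⟩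
      q ^ (7 ℕ.* 3 ℕ.^ suc k) * ψₖ 1 ^ (3 ℕ.^ suc k) * prodψ a b c′ qinv (3 ℕ.+ k) ∎
      where
      A = q ^ (7 ℕ.* 3 ℕ.^ k)
      B = ψₖ 1 ^ (3 ℕ.^ k)
      C = prodψ a b c′ qinv (2 ℕ.+ k)

mainTheorem16 : {c ℓ : Level} (R : CommutativeRing c ℓ) →
    let open CommutativeRing R in
    let open Gen R in
    (n : ℕ) → 2 ≤ n →
    (a b c' q qinv : Carrier) →
    q ^ 4 ≈ Qf a b c' → q * qinv ≈ 1# →
    Γcl n a b c' ≈
      q ^ (7 ℕ.* 3 ℕ.^ (n ∸ 2)) * ψ a b c' qinv 1 ^ (3 ℕ.^ (n ∸ 2))
        * prodψ a b c' qinv n * (ψ a b c' qinv (ℕ.suc n) - 1#)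
mainTheorem16 R (suc (suc k)) (s≤s (s≤s z≤n)) a b c′ q qinv q⁴≈Q q*qinv≈1 = begin
  ΓclG (Ω k) a b c′                    ≈⟨ Γcl≈F-even (Ω k) (wellFormed-Ω k) ⟩
  F (Ω k) false false false            ≈⟨ F-Ω k false false false ⟩
  X k                                  ≈⟨ X≈Y*[ψ-1] k ⟩
  Y k * (ψ a b c′ qinv (3 ℕ.+ k) - 1#) ≈⟨ *-congʳ (Y-closed-form k) ⟩
  q ^ (7 ℕ.* 3 ℕ.^ k) * ψ a b c′ qinv 1 ^ (3 ℕ.^ k) * prodψ a b c′ qinv (2 ℕ.+ k) * (ψ a b c′ qinv (3 ℕ.+ k) - 1#) ∎
  where
  open CommutativeRing R
  open Gen R
  open TransferMatrix R a b c′ using (F; Γcl≈F-even)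
  open PolygonCounts R a b c′
  open ClosedForm q qinv q⁴≈Q q*qinv≈1
  open import Relation.Binary.Reasoning.Setoid setoid
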